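{- Let $\Pi$ be a finite set of proposition symbols. Given a $\Pi$-program of $\mathrm{MPMSC}$ of size $m$ in which the maximum subindex of a diamond is $I$, one can construct an equivalent $\Pi$-program of $\mathrm{MSC}$ of size $\mathcal{O}(I+|\Pi_1|+m)$. The computation time of the constructed program is $2^{\mathcal{O}(|\Pi_1|)}$ times the computation time of the $\mathrm{MPMSC}$-program.
   Context: Proposition symbols: a countably infinite, linearly ordered set partitioned into ordinary and identifier symbols; for finite $\Pi$, $\Pi_1$ denotes its identifier symbols. A Kripke model over $\Pi$ is $M=(W,R,V)$, $W\ne\emptyset$, $R\subseteq W\times W$, $V:\Pi\to\mathcal P(W)$. With $p_1,\dots,p_\ell$ listing $\Pi_1$ in order, $\mathrm{ID}(w)$ is the $\ell$-bit string whose $i$th bit is $1$ iff $w\in V(p_i)$; $M$ has identifiers if $\mathrm{ID}$ is injective. If the successors of $w$ have identifiers $s_1<\dots<s_d$ lexicographically, the one with identifier $s_i$ is the $i$th neighbour of $w$. Sequences: a sequence $(\overline b_n)_n$ of $k$-bit strings with attention and print positions $A,P\subseteq[k]$ accepts in round $n$ if some position of $A$ in $\overline b_n$ is $1$ and all positions of $A$ in $\overline b_m$, $m<n$, are $0$; it then outputs the substring of $\overline b_n$ at positions $P$. MSC: $\mathrm{ML}(\Pi)$-formulas: $\varphi::=\top\mid p\mid\neg\varphi\mid(\varphi\wedge\varphi)\mid\Diamond\varphi$, usual semantics. A $\Pi$-program of MSC has distinct head predicates $Y_1,\dots,Y_k$ (fixed order), terminal clauses $Y_i(0):=\varphi_i$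 ($\varphi_i\in\mathrm{ML}(\Pi)$), iteration clauses $Y_i:=\psi_i$ (schemata, i.e. formulas that may also contain the $Y_j$), and sets of attention and print predicates among the heads. $Y_i^0=\varphi_i$; $Y_i^{n+1}$ is $\psi_i$ with each $Y_j$ replaced by $Y_j^n$. MPMSC: schemata built by $\varphi::=\top\mid p\mid X\mid\neg\varphi\mid(\varphi\wedge\varphi)\mid\Diamond_i\varphi$ ($i\in\mathbb Z_+$), where $\Diamond_i\varphi$ holds at $w$ iff $w$ has an $i$th neighbour and $\varphi$ holds there. A $\Pi$-program of MPMSC has heads $Y_1,\dots,Y_k$, diamond- and variable-free terminal clauses $Y_i(0):=\varphi_i$, and for each $i$ an iteration clause, either standard $Y_i:=\psi$ or conditional $Y_i:=_{\varphi_1,\dots,\varphi_n}\psi_1;\dots;\psi_n;\chi$, with conditions of modal depth $0$ and $\psi,\psi_j,\chi$ of modal depth at most $1$; plus attention and print predicates. Semantics: $Y_i^0=\varphi_i$; for a standard clause $Y_i^{n+1}=\psi^{n+1}$; for a conditional clause $Y_i^{n+1}=\bigvee_{j\le n}\big(\bigwedge_{j'<j}\neg\varphi_{j'}^{n+1}\wedge\varphi_j^{n+1}\wedge\psi_j^{n+1}\big)\vee\big(\bigwedge_{j\le n}\neg\varphi_j^{n+1}\wedge\chi^{n+1}\big)$, $\theta^{n+1}$ being $\theta$ with each $Y_j$ replaced by $Y_j^n$. For any program, the round-$n$ configuration at $w$ is the $k$-bit string whose $i$th bit is $1$ iff $(M,w)\models Y_i^n$; $w$ accepts/outputs in round $n$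 if this sequence does so w.r.t. positions of attention/print predicates; the output round is the computation time. Size = number of occurrences of proposition symbols, head predicates, $\top,\neg,\wedge$ and diamonds. Two programs are equivalent if on every Kripke model with identifiers interpreting all their symbols, at every node they produce the same output or neither produces any output. -}

module Defs where

open import Data.Nat using (ℕ; zero; suc; _+_; _*_; _^_; _≤_; _<_; _⊔_; _≡ᵇ_)
open import Data.Bool using (Bool; true; false; _∧_; _∨_; not; if_then_else_; T)
open import Data.Fin using (Fin; zero; suc)
open import Data.List using (List; []; _∷_; map; length)
open import Data.List.NonEmpty using (List⁺; _∷_)
open import Data.List.Membership.Propositional using (_∈_)
open import Data.List.Relation.Unary.AllPairs using (AllPairs)
open import Data.List.Relation.Unary.All using (All)
open import Data.Vec using (Vec; []; _∷_)
open import Data.Fin.Subset using (Subset)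
open import Data.Product using (Σ; _×_; _,_; ∃; ∃-syntax)
open import Data.Unit using (⊤)
open import Function using (_∘_)
open import Relation.Binary.PropositionalEquality using (_≡_)

anyF : ∀ n → (Fin n → Bool) → Bool
anyF zero    f = false
anyF (suc n) f = f zero ∨ anyF n (f ∘ suc)

countF : ∀ n → (Fin n → Bool) → ℕ
countF zero    f = 0
countF (suc n) f = (if f zero then 1 else 0) + countF n (f ∘ suc)

sumF : ∀ n → (Fin n → ℕ) → ℕ
sumF zero    f = 0
sumF (suc n) f = f zero + sumF n (f ∘ suc)

maxF : ∀ n → (Fin n → ℕ) → ℕ
maxF zero    f = 0
maxF (suc n) f = f zero ⊔ maxF n (f ∘ suc)

-- Proposition symbols: natural numbers with their usual linear order.
-- The partition into ordinary / identifier symbols is given by a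
-- predicate isId : ℕ → Bool (true = identifier symbol), quantified over
-- in the theorem.

record SymSet : Set where
  field
    elems  : List ℕ
    sorted : AllPairs _<_ elems
open SymSet public

idList : (ℕ → Bool) → List ℕ → List ℕ
idList isId []       = []
idList isId (p ∷ ps) = if isId p then p ∷ idList isId ps else idList isId ps

Π₁ : (ℕ → Bool) → SymSet → List ℕ
Π₁ isId Π = idList isId (elems Π)

-- A model with identifiers has at most 2^ℓ worlds
-- (ID is injective into ℓ-bit strings), so W is finite; we take
-- W = Fin (suc N) (non-empty) with classical (Bool-valued) R and V.

record Model : Set where
  field
    N : ℕ
    R : Fin (suc N) → Fin (suc N) → Bool
    V : ℕ → Fin (suc N) → Bool
open Model public

World : Model → Set
World M = Fin (suc (N M))

ID : (ℕ → Bool) → SymSet → (M : Model) → World M → List Bool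
ID isId Π M w = map (λ p → V M p w) (Π₁ isId Π)

HasIds : (ℕ → Bool) → SymSet → Model → Set
HasIds isId Π M = ∀ (w v : World M) → ID isId Π M w ≡ ID isId Π M v → w ≡ v

lexLt : List Bool → List Bool → Bool
lexLt []       _        = false
lexLt (_ ∷ _)  []       = false
lexLt (x ∷ xs) (y ∷ ys) = if x then (y ∧ lexLt xs ys) else (y ∨ lexLt xs ys)

-- v is the i-th neighbour of w (i ≥ 1): v is a successor of w and exactly
-- i-1 successors of w have lexicographically smaller identifiers.
isNb : (ℕ → Bool) → SymSet → (M : Model) → ℕ → World M → World M → Bool
isNb isId Π M i w v =
  R M w v ∧ (suc (countF (suc (N M))
                    (λ u → R M w u ∧ lexLt (ID isId Π M u) (ID isId Π M v)))
             ≡ᵇ i)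

hit : ∀ {k} → Subset k → (Fin k → Bool) → Bool
hit []       b = false
hit (s ∷ ss) b = (s ∧ b zero) ∨ hit ss (b ∘ suc)

restrict : ∀ {k} → Subset k → (Fin k → Bool) → List Bool
restrict []       b = []
restrict (s ∷ ss) b = if s then b zero ∷ restrict ss (b ∘ suc) else restrict ss (b ∘ suc)

Accepts : ∀ {k} → (ℕ → Fin k → Bool) → Subset k → ℕ → Set
Accepts b A n = T (hit A (b n)) × (∀ m → m < n → hit A (b m) ≡ false)

OutputsSeq : ∀ {k} → (ℕ → Fin k → Bool) → Subset k → Subset k → ℕ → List Bool → Set
OutputsSeq b A P n o = Accepts b A n × restrict P (b n) ≡ o

-- schemata over head predicates Y₁..Y_k (Fin k); ML(Π)-formulas are MSCFm 0
data MSCFm (k : ℕ) : Set where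
  ⊤'   : MSCFm k
  prop : ℕ → MSCFm k
  hd   : Fin k → MSCFm k
  ¬'   : MSCFm k → MSCFm k
  _∧'_ : MSCFm k → MSCFm k → MSCFm k
  ◇    : MSCFm k → MSCFm k

record MSCProg : Set where
  field
    k    : ℕ
    term : Fin k → MSCFm 0
    iter : Fin k → MSCFm k
    att  : Subset k
    prn  : Subset k
open MSCProg public

mscSymsIn : ∀ {k} → SymSet → MSCFm k → Set
mscSymsIn Π ⊤'       = ⊤
mscSymsIn Π (prop p) = p ∈ elems Π
mscSymsIn Π (hd _)   = ⊤
mscSymsIn Π (¬' φ)   = mscSymsIn Π φ
mscSymsIn Π (φ ∧' ψ) = mscSymsIn Π φ × mscSymsIn Π ψ
mscSymsIn Π (◇ φ)    = mscSymsIn Π φ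

MSCWF : SymSet → MSCProg → Set
MSCWF Π Q = ∀ i → mscSymsIn Π (term Q i) × mscSymsIn Π (iter Q i)

mscSizeF : ∀ {k} → MSCFm k → ℕ
mscSizeF ⊤'       = 1
mscSizeF (prop _) = 1
mscSizeF (hd _)   = 1
mscSizeF (¬' φ)   = suc (mscSizeF φ)
mscSizeF (φ ∧' ψ) = suc (mscSizeF φ + mscSizeF ψ)
mscSizeF (◇ φ)    = suc (mscSizeF φ)

-- each clause counts its left-hand head occurrence plus its right-hand side
mscSize : MSCProg → ℕ
mscSize Q = sumF (k Q) (λ i → suc (mscSizeF (term Q i)) + suc (mscSizeF (iter Q i)))

mscEval : ∀ {k} (M : Model) → (Fin k → World M → Bool) → MSCFm k → World M → Bool
mscEval M h ⊤'       w = true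
mscEval M h (prop p) w = V M p w
mscEval M h (hd j)   w = h j w
mscEval M h (¬' φ)   w = not (mscEval M h φ w)
mscEval M h (φ ∧' ψ) w = mscEval M h φ w ∧ mscEval M h ψ w
mscEval M h (◇ φ)    w = anyF (suc (N M)) (λ v → R M w v ∧ mscEval M h φ v)

mscRound : (Q : MSCProg) (M : Model) → ℕ → Fin (k Q) → World M → Bool
mscRound Q M zero    i w = mscEval M (λ ()) (term Q i) w
mscRound Q M (suc n) i w = mscEval M (mscRound Q M n) (iter Q i) w

-- node w outputs o in round n (so n is the computation time)
MSCOutputs : (Q : MSCProg) (M : Model) → World M → ℕ → List Bool → Set
MSCOutputs Q M w n o = OutputsSeq (λ m i → mscRound Q M m i w) (att Q) (prn Q) n o

data MPFm (k : ℕ) : Set where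
  ⊤'   : MPFm k
  prop : ℕ → MPFm k
  hd   : Fin k → MPFm k
  ¬'   : MPFm k → MPFm k
  _∧'_ : MPFm k → MPFm k → MPFm k
  ◇[_] : ℕ → MPFm k → MPFm k     -- ◇_i, required i ≥ 1 (see MPWF)

-- standard clause  Y_i := ψ,  or conditional clause
-- Y_i :=_{φ₁,…,φₙ} ψ₁;…;ψₙ;χ  given as the list of pairs (φ_j , ψ_j), n ≥ 1, and χ
data MPClause (k : ℕ) : Set where
  std  : MPFm k → MPClause k
  cond : List⁺ (MPFm k × MPFm k) → MPFm k → MPClause k

record MPProg : Set where
  field
    k    : ℕ
    term : Fin k → MPFm 0
    iter : Fin k → MPClause k
    att  : Subset k
    prn  : Subset k
open MPProg public

md : ∀ {k} → MPFm k → ℕ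
md ⊤'        = 0
md (prop _)  = 0
md (hd _)    = 0
md (¬' φ)    = md φ
md (φ ∧' ψ)  = md φ ⊔ md ψ
md (◇[ _ ] φ) = suc (md φ)

mpOK : ∀ {k} → SymSet → MPFm k → Set
mpOK Π ⊤'         = ⊤
mpOK Π (prop p)   = p ∈ elems Π
mpOK Π (hd _)     = ⊤
mpOK Π (¬' φ)     = mpOK Π φ
mpOK Π (φ ∧' ψ)   = mpOK Π φ × mpOK Π ψ
mpOK Π (◇[ i ] φ) = 1 ≤ i × mpOK Π φ

clauseWF : ∀ {k} → SymSet → MPClause k → Set
clauseWF Π (std ψ) = mpOK Π ψ × md ψ ≤ 1
clauseWF Π (cond (c ∷ cs) χ) =
  All (λ { (φ , ψ) → mpOK Π φ × md φ ≡ 0 × mpOK Π ψ × md ψ ≤ 1 }) (c ∷ cs)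
  × mpOK Π χ × md χ ≤ 1

MPWF : SymSet → MPProg → Set
MPWF Π P = ∀ i → (mpOK Π (term P i) × md (term P i) ≡ 0) × clauseWF Π (iter P i)

mpSizeF : ∀ {k} → MPFm k → ℕ
mpSizeF ⊤'         = 1
mpSizeF (prop _)   = 1
mpSizeF (hd _)     = 1
mpSizeF (¬' φ)     = suc (mpSizeF φ)
mpSizeF (φ ∧' ψ)   = suc (mpSizeF φ + mpSizeF ψ)
mpSizeF (◇[ _ ] φ) = suc (mpSizeF φ)

sizePairs : ∀ {k} → List (MPFm k × MPFm k) → ℕ
sizePairs []             = 0
sizePairs ((φ , ψ) ∷ cs) = mpSizeF φ + mpSizeF ψ + sizePairs cs

clauseSize : ∀ {k} → MPClause k → ℕ
clauseSize (std ψ)           = mpSizeF ψ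
clauseSize (cond (c ∷ cs) χ) = sizePairs (c ∷ cs) + mpSizeF χ

mpSize : MPProg → ℕ
mpSize P = sumF (k P) (λ i → suc (mpSizeF (term P i)) + suc (clauseSize (iter P i)))

maxDia : ∀ {k} → MPFm k → ℕ
maxDia ⊤'         = 0
maxDia (prop _)   = 0
maxDia (hd _)     = 0
maxDia (¬' φ)     = maxDia φ
maxDia (φ ∧' ψ)   = maxDia φ ⊔ maxDia ψ
maxDia (◇[ i ] φ) = i ⊔ maxDia φ

maxDiaPairs : ∀ {k} → List (MPFm k × MPFm k) → ℕ
maxDiaPairs []             = 0
maxDiaPairs ((φ , ψ) ∷ cs) = maxDia φ ⊔ maxDia ψ ⊔ maxDiaPairs cs

maxDiaClause : ∀ {k} → MPClause k → ℕ
maxDiaClause (std ψ)           = maxDia ψ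
maxDiaClause (cond (c ∷ cs) χ) = maxDiaPairs (c ∷ cs) ⊔ maxDia χ

-- maximum subindex I of a diamond in P (0 if there are none)
maxIndex : MPProg → ℕ
maxIndex P = maxF (k P) (λ i → maxDia (term P i) ⊔ maxDiaClause (iter P i))

mpEval : ∀ {k} (isId : ℕ → Bool) (Π : SymSet) (M : Model) →
         (Fin k → World M → Bool) → MPFm k → World M → Bool
mpEval isId Π M h ⊤'         w = true
mpEval isId Π M h (prop p)   w = V M p w
mpEval isId Π M h (hd j)     w = h j w
mpEval isId Π M h (¬' φ)     w = not (mpEval isId Π M h φ w)
mpEval isId Π M h (φ ∧' ψ)   w = mpEval isId Π M h φ w ∧ mpEval isId Π M h ψ w
mpEval isId Π M h (◇[ i ] φ) w =
  anyF (suc (N M)) (λ v → isNb isId Π M i w v ∧ mpEval isId Π M h φ v)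

-- ⋁_{j≤n} (⋀_{j'<j} ¬φ_j' ∧ φ_j ∧ ψ_j) ∨ (⋀_{j≤n} ¬φ_j ∧ χ),
-- unfolded recursively on the list of (φ_j, ψ_j)
condVal : ∀ {k} (isId : ℕ → Bool) (Π : SymSet) (M : Model) →
          (Fin k → World M → Bool) → List (MPFm k × MPFm k) → MPFm k → World M → Bool
condVal isId Π M h []             χ w = mpEval isId Π M h χ w
condVal isId Π M h ((φ , ψ) ∷ cs) χ w =
  (mpEval isId Π M h φ w ∧ mpEval isId Π M h ψ w)
  ∨ (not (mpEval isId Π M h φ w) ∧ condVal isId Π M h cs χ w)

clauseEval : ∀ {k} (isId : ℕ → Bool) (Π : SymSet) (M : Model) →
             (Fin k → World M → Bool) → MPClause k → World M → Bool
clauseEval isId Π M h (std ψ)           w = mpEval isId Π M h ψ w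
clauseEval isId Π M h (cond (c ∷ cs) χ) w = condVal isId Π M h (c ∷ cs) χ w

mpRound : (isId : ℕ → Bool) (Π : SymSet) (P : MPProg) (M : Model) →
          ℕ → Fin (k P) → World M → Bool
mpRound isId Π P M zero    i w = mpEval isId Π M (λ ()) (term P i) w
mpRound isId Π P M (suc n) i w = clauseEval isId Π M (mpRound isId Π P M n) (iter P i) w

MPOutputs : (isId : ℕ → Bool) (Π : SymSet) (P : MPProg) (M : Model) →
            World M → ℕ → List Bool → Set
MPOutputs isId Π P M w n o =
  OutputsSeq (λ m i → mpRound isId Π P M m i w) (att P) (prn P) n o

Equivalent : (ℕ → Bool) → SymSet → MPProg → MSCProg → Set
Equivalent isId Π P Q =
  ∀ (M : Model) → HasIds isId Π M → ∀ (w : World M) (o : List Bool) →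
    ((∃[ n ] MPOutputs isId Π P M w n o) → (∃[ n ] MSCOutputs Q M w n o))
    × ((∃[ n ] MSCOutputs Q M w n o) → (∃[ n ] MPOutputs isId Π P M w n o))

-- computation time of Q is at most c · 2^(c·ℓ) times that of P
-- (with (1+n) in place of n, to handle computation time 0)
TimeBound : (ℕ → Bool) → SymSet → ℕ → MPProg → MSCProg → Set
TimeBound isId Π c P Q =
  ∀ (M : Model) → HasIds isId Π M → ∀ (w : World M) (n : ℕ) (o : List Bool) →
    MPOutputs isId Π P M w n o →
    ∃[ n' ] (MSCOutputs Q M w n' o × n' ≤ c * 2 ^ (c * length (Π₁ isId Π)) * suc n)

-- An MPMSC program P is simulated by an MSC program Q that spends 2^ℓ · (4 + ℓ) rounds on each
-- round of P, where ℓ = |Π₁|. During a simulated round, Q runs a binary counter through all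
-- ℓ-bit strings y in increasing order. In the sweep for y a plain diamond detects the successor
-- whose identifier is y (identifiers are unique), and the number of successors swept before it
-- tells which neighbour it is; so each occurrence ◇ᵢ φ of P gets its own head, which after the
-- last sweep holds the value of ◇ᵢ φ, and the heads of P are then updated. Copies of P's heads
-- that are true only at the first round of each simulated round are Q's attention and print
-- predicates, so Q outputs what P outputs, 2^ℓ · (4 + ℓ) ≤ 60 · 2^(60ℓ) times later. Apart from
-- the translated clauses of P, Q has I + O(ℓ) + one head per diamond occurrence, each of
-- constant size, which gives the size bound.

module Submission where

open import Defs
open import Data.Bool using (Bool; true; false; _∧_; _∨_; not; if_then_else_; T; _xor_)
open import Data.Bool.Properties
  using (∧-zeroʳ; ∧-identityʳ; ∨-identityʳ; ∨-zeroʳ; xor-identityʳ; xor-assoc; ∧-distribʳ-∨; ∧-distribˡ-∨; ∧-distribˡ-xor)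
open import Data.Empty using (⊥; ⊥-elim)
open import Data.Fin using (Fin; zero; suc; toℕ; _↑ˡ_)
import Data.Fin.Properties as FP
open import Data.List using (List; []; _∷_; map; length; _++_; drop; replicate; applyUpTo; concat; tabulate)
open import Data.List.NonEmpty using (_∷_)
import Data.List.Properties as LP
open import Data.List.Membership.Propositional using (_∈_)
open import Data.List.Relation.Unary.All as All using (All; []; _∷_)
open import Data.List.Relation.Unary.All.Properties using (++⁺; concat⁺; tabulate⁺)
open import Data.List.Relation.Unary.Any using (here; there)
open import Data.Maybe as Maybe using (Maybe; just; nothing)
open import Data.Nat
  using (ℕ; zero; suc; _+_; _*_; _∸_; _^_; _≤_; _<_; _≡ᵇ_; _<ᵇ_; _≤ᵇ_; z≤n; s≤s; _⊔_; pred; >-nonZero)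
open import Data.Nat.Properties
open import Data.Nat.ListAction using (sum)
open import Data.Nat.ListAction.Properties using (sum-++)
open import Data.Nat.Tactic.RingSolver using (solve-∀)
open import Data.Product using (_×_; _,_; proj₁; proj₂; ∃-syntax)
open import Data.Sum using (inj₁; inj₂)
open import Data.Unit using (⊤; tt)
open import Data.Vec as Vec using (Vec; []; _∷_)
open import Function using (_∘_)
open import Relation.Binary.PropositionalEquality

fromBool : Bool → ℕ
fromBool b = if b then 1 else 0

anyF-cong : ∀ n {f g : Fin n → Bool} → (∀ i → f i ≡ g i) → anyF n f ≡ anyF n g
anyF-cong zero    e = refl
anyF-cong (suc n) e = cong₂ _∨_ (e zero) (anyF-cong n (e ∘ suc))

anyF-∨ : ∀ n (f g : Fin n → Bool) → anyF n (λ i → f i ∨ g i) ≡ anyF n f ∨ anyF n g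
anyF-∨ zero    f g = refl
anyF-∨ (suc n) f g rewrite anyF-∨ n (f ∘ suc) (g ∘ suc) =
  interchange (f zero) (g zero) (anyF n (f ∘ suc)) (anyF n (g ∘ suc))
  where
  interchange : ∀ a b c d → (a ∨ b) ∨ (c ∨ d) ≡ (a ∨ c) ∨ (b ∨ d)
  interchange true  b     c d = refl
  interchange false true  c d = sym (∨-zeroʳ c)
  interchange false false c d = refl

anyF-∧ʳ : ∀ n (f : Fin n → Bool) c → anyF n (λ i → f i ∧ c) ≡ anyF n f ∧ c
anyF-∧ʳ zero    f c = refl
anyF-∧ʳ (suc n) f c rewrite anyF-∧ʳ n (f ∘ suc) c = sym (∧-distribʳ-∨ c (f zero) (anyF n (f ∘ suc)))

anyF-false : ∀ n (f : Fin n → Bool) → (∀ i → f i ≡ false) → anyF n f ≡ false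
anyF-false zero    f e = refl
anyF-false (suc n) f e rewrite e zero = anyF-false n (f ∘ suc) (e ∘ suc)

countF-cong : ∀ n {f g : Fin n → Bool} → (∀ i → f i ≡ g i) → countF n f ≡ countF n g
countF-cong zero    e = refl
countF-cong (suc n) e = cong₂ _+_ (cong fromBool (e zero)) (countF-cong n (e ∘ suc))

countF-false : ∀ n (f : Fin n → Bool) → (∀ i → f i ≡ false) → countF n f ≡ 0
countF-false zero    f e = refl
countF-false (suc n) f e rewrite e zero = countF-false n (f ∘ suc) (e ∘ suc)

countF-∨-disjoint : ∀ n (f g : Fin n → Bool) → (∀ i → f i ∧ g i ≡ false) →
                    countF n (λ i → f i ∨ g i) ≡ countF n f + countF n g
countF-∨-disjoint zero    f g d = refl
countF-∨-disjoint (suc n) f g d rewrite countF-∨-disjoint n (f ∘ suc) (g ∘ suc) (d ∘ suc) =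
  step (f zero) (g zero) (d zero) (countF n (f ∘ suc)) (countF n (g ∘ suc))
  where
  step : ∀ a b → a ∧ b ≡ false → ∀ x y → fromBool (a ∨ b) + (x + y) ≡ (fromBool a + x) + (fromBool b + y)
  step true  false _ x y = refl
  step false true  _ x y = sym (+-suc x y)
  step false false _ x y = refl

countF-unique : ∀ n (f : Fin n → Bool) → (∀ i j → f i ≡ true → f j ≡ true → i ≡ j) →
                countF n f ≡ fromBool (anyF n f)
countF-unique zero    f u = refl
countF-unique (suc n) f u with f zero in e0
... | true  = cong suc (countF-false n (f ∘ suc) rest-false)
  where
  rest-false : ∀ i → f (suc i) ≡ false
  rest-false i with f (suc i) in e1
  ... | true  with () ← u zero (suc i) e0 e1
  ... | false = refl
... | false = countF-unique n (f ∘ suc) (λ i j a b → FP.suc-injective (u (suc i) (suc j) a b))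

sumF-cong : ∀ n {f g : Fin n → ℕ} → (∀ i → f i ≡ g i) → sumF n f ≡ sumF n g
sumF-cong zero    e = refl
sumF-cong (suc n) e = cong₂ _+_ (e zero) (sumF-cong n (e ∘ suc))

sumF-mono : ∀ n (f g : Fin n → ℕ) → (∀ i → f i ≤ g i) → sumF n f ≤ sumF n g
sumF-mono zero    f g h = z≤n
sumF-mono (suc n) f g h = +-mono-≤ (h zero) (sumF-mono n (f ∘ suc) (g ∘ suc) (h ∘ suc))

2≤sumF : ∀ n (f : Fin n → ℕ) → (∀ i → 2 ≤ f i) → 1 ≤ n → 2 ≤ sumF n f
2≤sumF (suc n) f h _ = ≤-trans (h zero) (m≤m+n _ _)

sumF-* : ∀ n c (f : Fin n → ℕ) → sumF n (λ i → c * f i) ≡ c * sumF n f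
sumF-* zero    c f = sym (*-zeroʳ c)
sumF-* (suc n) c f = trans (cong (c * f zero +_) (sumF-* n c (f ∘ suc))) (sym (*-distribˡ-+ c (f zero) _))

≤-maxF : ∀ n (f : Fin n → ℕ) i → f i ≤ maxF n f
≤-maxF (suc n) f zero    = m≤m⊔n _ _
≤-maxF (suc n) f (suc i) = ≤-trans (≤-maxF n (f ∘ suc) i) (m≤n⊔m _ _)

hit-cong : ∀ {m} (A : Vec Bool m) {f g : Fin m → Bool} → (∀ i → f i ≡ g i) → hit A f ≡ hit A g
hit-cong []      e = refl
hit-cong (a ∷ A) e = cong₂ (λ x y → (a ∧ x) ∨ y) (e zero) (hit-cong A (e ∘ suc))

restrict-cong : ∀ {m} (A : Vec Bool m) {f g : Fin m → Bool} → (∀ i → f i ≡ g i) → restrict A f ≡ restrict A g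
restrict-cong []          e = refl
restrict-cong (true ∷ A)  e = cong₂ _∷_ (e zero) (restrict-cong A (e ∘ suc))
restrict-cong (false ∷ A) e = restrict-cong A (e ∘ suc)

hit-∧ˡ : ∀ {m} (A : Vec Bool m) c (f : Fin m → Bool) → hit A (λ i → c ∧ f i) ≡ c ∧ hit A f
hit-∧ˡ []      c f = sym (∧-zeroʳ c)
hit-∧ˡ (a ∷ A) c f rewrite hit-∧ˡ A c (f ∘ suc) = distribute a c (f zero) (hit A (f ∘ suc))
  where
  distribute : ∀ a c x h → (a ∧ (c ∧ x)) ∨ (c ∧ h) ≡ c ∧ ((a ∧ x) ∨ h)
  distribute true  true  x h = refl
  distribute true  false x h = refl
  distribute false true  x h = refl
  distribute false false x h = refl

hit-padded : ∀ {m} r (A : Vec Bool m) (b : Fin (m + r) → Bool) → hit (A Vec.++ Vec.replicate r false) b ≡ hit A (λ i → b (i ↑ˡ r))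
hit-padded r []      b = nothing-hit r b
  where
  nothing-hit : ∀ r (b : Fin r → Bool) → hit (Vec.replicate r false) b ≡ false
  nothing-hit zero    b = refl
  nothing-hit (suc r) b = nothing-hit r (b ∘ suc)
hit-padded r (a ∷ A) b = cong ((a ∧ b zero) ∨_) (hit-padded r A (b ∘ suc))

restrict-padded : ∀ {m} r (A : Vec Bool m) (b : Fin (m + r) → Bool) →
                  restrict (A Vec.++ Vec.replicate r false) b ≡ restrict A (λ i → b (i ↑ˡ r))
restrict-padded r []          b = nothing-printed r b
  where
  nothing-printed : ∀ r (b : Fin r → Bool) → restrict (Vec.replicate r false) b ≡ []
  nothing-printed zero    b = refl
  nothing-printed (suc r) b = nothing-printed r (b ∘ suc)
restrict-padded r (true ∷ A)  b = cong (b zero ∷_) (restrict-padded r A (b ∘ suc))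
restrict-padded r (false ∷ A) b = restrict-padded r A (b ∘ suc)

-- Bit strings (most significant bit first)

eqBits : List Bool → List Bool → Bool
eqBits []       []       = true
eqBits []       (_ ∷ _)  = false
eqBits (_ ∷ _)  []       = false
eqBits (a ∷ as) (b ∷ bs) = not (a xor b) ∧ eqBits as bs

eqBits⇒≡ : ∀ x y → eqBits x y ≡ true → x ≡ y
eqBits⇒≡ []           []           e = refl
eqBits⇒≡ (true ∷ as)  (true ∷ bs)  e = cong (true ∷_) (eqBits⇒≡ as bs e)
eqBits⇒≡ (false ∷ as) (false ∷ bs) e = cong (false ∷_) (eqBits⇒≡ as bs e)

lexLe : List Bool → List Bool → Bool
lexLe x y = lexLt x y ∨ eqBits x y

lexLt-irrefl : ∀ x → lexLt x x ≡ false
lexLt-irrefl []          = refl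
lexLt-irrefl (true ∷ x)  = lexLt-irrefl x
lexLt-irrefl (false ∷ x) = lexLt-irrefl x

bitAt : List Bool → ℕ → Bool
bitAt []       i       = false
bitAt (b ∷ bs) zero    = b
bitAt (b ∷ bs) (suc i) = bitAt bs i

applyUpTo-cong : ∀ {A : Set} n (f g : ℕ → A) → (∀ i → i < n → f i ≡ g i) →
                 applyUpTo f n ≡ applyUpTo g n
applyUpTo-cong zero    f g e = refl
applyUpTo-cong (suc n) f g e = cong₂ _∷_ (e 0 (s≤s z≤n)) (applyUpTo-cong n (f ∘ suc) (g ∘ suc) (λ i → e (suc i) ∘ s≤s))

applyUpTo-bitAt : ∀ y → applyUpTo (bitAt y) (length y) ≡ y
applyUpTo-bitAt []      = refl
applyUpTo-bitAt (b ∷ y) = cong (b ∷_) (applyUpTo-bitAt y)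

allOnes : List Bool → Bool
allOnes []       = true
allOnes (b ∷ bs) = b ∧ allOnes bs

allZeros : List Bool → Bool
allZeros []       = true
allZeros (b ∷ bs) = not b ∧ allZeros bs

zeros : ℕ → List Bool
zeros n = replicate n false

allZeros-zeros : ∀ n → allZeros (zeros n) ≡ true
allZeros-zeros zero    = refl
allZeros-zeros (suc n) = allZeros-zeros n

bitAt-zeros : ∀ n i → bitAt (zeros n) i ≡ false
bitAt-zeros zero    i       = refl
bitAt-zeros (suc n) zero    = refl
bitAt-zeros (suc n) (suc i) = bitAt-zeros n i

lexLt-zeros : ∀ x n → lexLt x (zeros n) ≡ false
lexLt-zeros []          n       = refl
lexLt-zeros (a ∷ x)     zero    = refl
lexLt-zeros (true ∷ x)  (suc n) = refl
lexLt-zeros (false ∷ x) (suc n) = lexLt-zeros x n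

lexLe-allOnes : ∀ x y → length x ≡ length y → allOnes y ≡ true → lexLe x y ≡ true
lexLe-allOnes []          []         _ _ = refl
lexLe-allOnes (true ∷ x)  (true ∷ y) l e = lexLe-allOnes x y (suc-injective l) e
lexLe-allOnes (false ∷ x) (true ∷ y) l e = refl

allOnes-drop : ∀ y i → i < length y → allOnes (drop i y) ≡ bitAt y i ∧ allOnes (drop (suc i) y)
allOnes-drop (b ∷ y) zero    lt       = refl
allOnes-drop (b ∷ y) (suc i) (s≤s lt) = allOnes-drop y i lt

drop-length : ∀ (y : List Bool) → drop (length y) y ≡ []
drop-length []      = refl
drop-length (b ∷ y) = drop-length y

-- Bit i flips iff all later bits are 1.
increment : List Bool → List Bool
increment []       = []
increment (b ∷ bs) = (b xor allOnes bs) ∷ increment bs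

length-increment : ∀ y → length (increment y) ≡ length y
length-increment []      = refl
length-increment (b ∷ y) = cong suc (length-increment y)

bitAt-increment : ∀ y i → i < length y → bitAt (increment y) i ≡ bitAt y i xor allOnes (drop (suc i) y)
bitAt-increment (b ∷ y) zero    lt       = refl
bitAt-increment (b ∷ y) (suc i) (s≤s lt) = bitAt-increment y i lt

increment-allOnes : ∀ y → allOnes y ≡ true → increment y ≡ zeros (length y)
increment-allOnes []         e = refl
increment-allOnes (true ∷ y) e rewrite e = cong (false ∷_) (increment-allOnes y e)

allZeros-increment : ∀ y → allZeros (increment y) ≡ allOnes y
allZeros-increment []      = refl
allZeros-increment (b ∷ y) rewrite allZeros-increment y = flip-carry b (allOnes y)
  where
  flip-carry : ∀ b a → not (b xor a) ∧ a ≡ b ∧ a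
  flip-carry true  true  = refl
  flip-carry true  false = refl
  flip-carry false true  = refl
  flip-carry false false = refl

lexLt-increment : ∀ x y → length x ≡ length y → allOnes y ≡ false →
                  lexLt x (increment y) ≡ lexLe x y
lexLt-increment (a ∷ x) (b ∷ y) l e with allOnes y in ones
... | true  = carry a b e (increment-allOnes y ones) (lexLe-allOnes x y (suc-injective l) ones)
  where
  carry : ∀ a b → b ∧ true ≡ false → increment y ≡ zeros (length y) → lexLe x y ≡ true →
          lexLt (a ∷ x) ((b xor true) ∷ increment y) ≡ lexLe (a ∷ x) (b ∷ y)
  carry true  false _ inc le rewrite inc | lexLt-zeros x (length y) = refl
  carry false false _ inc le = sym le
... | false = no-carry a b (lexLt-increment x y (suc-injective l) ones)
  where
  no-carry : ∀ a b → lexLt x (increment y) ≡ lexLe x y →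
             lexLt (a ∷ x) ((b xor false) ∷ increment y) ≡ lexLe (a ∷ x) (b ∷ y)
  no-carry true  true  ih = ih
  no-carry true  false ih = refl
  no-carry false true  ih = refl
  no-carry false false ih = ih

value : List Bool → ℕ
value []       = 0
value (b ∷ bs) = (if b then 2 ^ length bs else 0) + value bs

value-zeros : ∀ n → value (zeros n) ≡ 0
value-zeros zero    = refl
value-zeros (suc n) = value-zeros n

value-allZeros : ∀ y → allZeros y ≡ true → value y ≡ 0
value-allZeros []          e = refl
value-allZeros (false ∷ y) e = value-allZeros y e

value≡0⇒zeros : ∀ y → value y ≡ 0 → y ≡ zeros (length y)
value≡0⇒zeros []          e = refl
value≡0⇒zeros (false ∷ y) e = cong (false ∷_) (value≡0⇒zeros y e)
value≡0⇒zeros (true ∷ y)  e = ⊥-elim (<⇒≢ (≤-trans (m^n>0 2 (length y)) (m≤m+n _ (value y))) (sym e))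

2^n+2^n : ∀ n → 2 ^ n + 2 ^ n ≡ 2 ^ suc n
2^n+2^n n = cong (2 ^ n +_) (sym (+-identityʳ (2 ^ n)))

value-allOnes : ∀ y → allOnes y ≡ true → suc (value y) ≡ 2 ^ length y
value-allOnes []         e = refl
value-allOnes (true ∷ y) e = begin
  suc (2 ^ length y + value y)  ≡⟨ sym (+-suc (2 ^ length y) (value y)) ⟩
  2 ^ length y + suc (value y)  ≡⟨ cong (2 ^ length y +_) (value-allOnes y e) ⟩
  2 ^ length y + 2 ^ length y   ≡⟨ 2^n+2^n (length y) ⟩
  2 ^ suc (length y)            ∎
  where open ≡-Reasoning

value<2^length : ∀ y → value y < 2 ^ length y
value<2^length []          = ≤-refl
value<2^length (true ∷ y)  = begin-strict
  2 ^ length y + value y        <⟨ +-monoʳ-< (2 ^ length y) (value<2^length y) ⟩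
  2 ^ length y + 2 ^ length y   ≡⟨ 2^n+2^n (length y) ⟩
  2 ^ suc (length y)            ∎
  where open ≤-Reasoning
value<2^length (false ∷ y) = <-≤-trans (value<2^length y) (≤-trans (m≤m+n _ _) (≤-reflexive (2^n+2^n (length y))))

value-increment : ∀ y → allOnes y ≡ false → value (increment y) ≡ suc (value y)
value-increment (b ∷ y) e with allOnes y in ones
value-increment (false ∷ y) e | true
  rewrite increment-allOnes y ones | value-zeros (length y) | LP.length-replicate (length y) {false} =
  trans (+-identityʳ _) (sym (value-allOnes y ones))
value-increment (b ∷ y) e | false rewrite value-increment y ones | length-increment y with b
... | true  = +-suc _ _
... | false = refl

≡ᵇ-refl : ∀ n → (n ≡ᵇ n) ≡ true
≡ᵇ-refl zero    = refl
≡ᵇ-refl (suc n) = ≡ᵇ-refl n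

≢⇒≡ᵇ≡false : ∀ {m n} → m ≢ n → (m ≡ᵇ n) ≡ false
≢⇒≡ᵇ≡false {m} {n} m≢n with m ≡ᵇ n in e
... | true  = ⊥-elim (m≢n (≡ᵇ⇒≡ m n (subst T (sym e) _)))
... | false = refl

≡ᵇ⇒≡′ : ∀ {m n} → (m ≡ᵇ n) ≡ true → m ≡ n
≡ᵇ⇒≡′ {m} {n} e = ≡ᵇ⇒≡ m n (subst T (sym e) _)

≡ᵇ-cong : ∀ {a b c d} → (a ≡ b → c ≡ d) → (c ≡ d → a ≡ b) → (a ≡ᵇ b) ≡ (c ≡ᵇ d)
≡ᵇ-cong {a} {b} {c} {d} f g with a ≡ᵇ b in e₁ | c ≡ᵇ d in e₂
... | true  | true  = refl
... | false | false = refl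
... | true  | false = ⊥-elim (subst T e₂ (≡⇒≡ᵇ c d (f (≡ᵇ⇒≡′ e₁))))
... | false | true  = ⊥-elim (subst T e₁ (≡⇒≡ᵇ a b (g (≡ᵇ⇒≡′ e₂))))

<⇒<ᵇ≡true : ∀ {m n} → m < n → (m <ᵇ n) ≡ true
<⇒<ᵇ≡true {zero}  {suc n} _        = refl
<⇒<ᵇ≡true {suc m} {suc n} (s≤s lt) = <⇒<ᵇ≡true lt

m+n<ᵇm≡false : ∀ m n → (m + n <ᵇ m) ≡ false
m+n<ᵇm≡false zero    zero    = refl
m+n<ᵇm≡false zero    (suc n) = refl
m+n<ᵇm≡false (suc m) n       = m+n<ᵇm≡false m n

≤ᵇ-suc-suc : ∀ a b → (suc a ≤ᵇ suc b) ≡ (a ≤ᵇ b)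
≤ᵇ-suc-suc zero    b = refl
≤ᵇ-suc-suc (suc a) b = refl

≤⇒≤ᵇ≡true : ∀ {a b} → a ≤ b → (a ≤ᵇ b) ≡ true
≤⇒≤ᵇ≡true {zero}  _         = refl
≤⇒≤ᵇ≡true {suc a} (s≤s a≤b) = trans (≤ᵇ-suc-suc a _) (≤⇒≤ᵇ≡true a≤b)

>⇒≤ᵇ≡false : ∀ {a b} → b < a → (a ≤ᵇ b) ≡ false
>⇒≤ᵇ≡false {suc a} {zero}  _         = refl
>⇒≤ᵇ≡false {suc a} {suc b} (s≤s b<a) = trans (≤ᵇ-suc-suc a b) (>⇒≤ᵇ≡false b<a)

≤ᵇ-suc : ∀ a b → (a ≤ᵇ suc b) ≡ ((a ≤ᵇ b) xor (suc b ≡ᵇ a))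
≤ᵇ-suc zero          b       = refl
≤ᵇ-suc (suc zero)    zero    = refl
≤ᵇ-suc (suc (suc a)) zero    = refl
≤ᵇ-suc (suc a)       (suc b) = trans (≤ᵇ-suc-suc a (suc b)) (trans (≤ᵇ-suc a b) (cong (_xor (suc b ≡ᵇ a)) (sym (≤ᵇ-suc-suc a b))))

≤ᵇ-+-fromBool : ∀ j c b → (suc j ≤ᵇ c + fromBool b) ≡ ((suc j ≤ᵇ c) ∨ ((j ≤ᵇ c) ∧ b))
≤ᵇ-+-fromBool j c false rewrite +-identityʳ c | ∧-zeroʳ (j ≤ᵇ c) = sym (∨-identityʳ _)
≤ᵇ-+-fromBool j c true rewrite +-comm c 1 = one-more j c
  where
  one-more : ∀ j c → (suc j ≤ᵇ suc c) ≡ ((suc j ≤ᵇ c) ∨ ((j ≤ᵇ c) ∧ true))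
  one-more zero    zero    = refl
  one-more zero    (suc c) = refl
  one-more (suc j) zero    = refl
  one-more (suc j) (suc c) = trans (≤ᵇ-suc-suc (suc j) (suc c)) (trans (one-more j c)
                               (cong₂ (λ a b → a ∨ (b ∧ true)) (sym (≤ᵇ-suc-suc (suc j) c)) (sym (≤ᵇ-suc-suc j c))))

suc≡ᵇ⇔between : ∀ i c → 1 ≤ i → (suc c ≡ᵇ i) ≡ ((i ∸ 1 ≤ᵇ c) ∧ not (i ≤ᵇ c))
suc≡ᵇ⇔between (suc i) c _ = exact i c
  where
  exact : ∀ i c → (c ≡ᵇ i) ≡ ((i ≤ᵇ c) ∧ not (suc i ≤ᵇ c))
  exact zero    zero    = refl
  exact zero    (suc c) = refl
  exact (suc i) zero    = refl
  exact (suc i) (suc c) = trans (exact i c) (cong₂ (λ a b → a ∧ not b) (sym (≤ᵇ-suc-suc i c)) (sym (≤ᵇ-suc-suc (suc i) c)))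

record Clock : Set where
  constructor ⟨_,_,_⟩
  field
    phase   : ℕ
    counter : List Bool
    offset  : ℕ
open Clock public

quotient-unique : ∀ {d} a b r → r < d → a * d ≡ b * d + r → a ≡ b × r ≡ 0
quotient-unique         zero    zero    r lt e = refl , sym e
quotient-unique {d}     zero    (suc b) r lt e =
  ⊥-elim (<⇒≢ (<-≤-trans (≤-trans (s≤s z≤n) lt) (≤-trans (m≤m+n d (b * d)) (m≤m+n _ r))) e)
quotient-unique {d}     (suc a) zero    r lt e =
  ⊥-elim (<-irrefl refl (≤-<-trans (≤-trans (m≤m+n d (a * d)) (≤-reflexive e)) lt))
quotient-unique {d}     (suc a) (suc b) r lt e
  with quotient-unique a b r lt (+-cancelˡ-≡ d (a * d) (b * d + r) (trans e (+-assoc d (b * d) r)))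
... | refl , r≡0 = refl , r≡0

-- One simulated round takes 2^ℓ sweeps (one per ℓ-bit string, in increasing order),
-- each of 4 + ℓ ticks.
module Schedule (ℓ : ℕ) where

  sweepLength : ℕ
  sweepLength = 4 + ℓ

  roundLength : ℕ
  roundLength = 2 ^ ℓ * sweepLength

  tick : Clock → Clock
  tick ⟨ p , y , s ⟩ =
    if s ≡ᵇ 3 + ℓ
    then (if allOnes y then ⟨ suc p , zeros ℓ , 0 ⟩ else ⟨ p , increment y , 0 ⟩)
    else ⟨ p , y , suc s ⟩

  clock : ℕ → Clock
  clock zero    = ⟨ 0 , zeros ℓ , 0 ⟩
  clock (suc N) = tick (clock N)

  WellTimed : ℕ → Clock → Set
  WellTimed N ⟨ p , y , s ⟩ =
    length y ≡ ℓ × s ≤ 3 + ℓ × N ≡ p * roundLength + (value y * sweepLength + s)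

  clock-wellTimed : ∀ N → WellTimed N (clock N)
  clock-wellTimed zero    = LP.length-replicate ℓ , z≤n , sym (cong (λ v → v * sweepLength + 0) (value-zeros ℓ))
  clock-wellTimed (suc N) with clock N | clock-wellTimed N
  ... | ⟨ p , y , s ⟩ | len , s≤ , N≡ with s ≡ᵇ 3 + ℓ in s≟
  ...   | false = len , ≤∧≢⇒< s≤ (λ eq → subst T s≟ (≡⇒≡ᵇ s (3 + ℓ) eq)) ,
                  trans (cong suc N≡) (sym (trans (cong (p * roundLength +_) (+-suc _ s)) (+-suc _ _)))
  ...   | true with refl ← ≡ᵇ⇒≡′ {s} {3 + ℓ} s≟ with allOnes y in ones
  ...     | false = trans (length-increment y) len , z≤n ,
                    trans (cong suc N≡) (trans (next-sweep p roundLength (value y) ℓ)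
                      (cong (λ v → p * roundLength + (v * sweepLength + 0)) (sym (value-increment y ones))))
    where
    next-sweep : ∀ p r v ℓ → suc (p * r + (v * (4 + ℓ) + (3 + ℓ))) ≡ p * r + (suc v * (4 + ℓ) + 0)
    next-sweep = solve-∀
  ...     | true  = LP.length-replicate ℓ , z≤n , (begin
    suc N                                                      ≡⟨ cong suc N≡ ⟩
    suc (p * (2 ^ ℓ * L) + (value y * L + (3 + ℓ)))            ≡⟨ cong (λ q → suc (p * (q * L) + (value y * L + (3 + ℓ)))) (sym full) ⟩
    suc (p * (suc (value y) * L) + (value y * L + (3 + ℓ)))    ≡⟨ next-round p (value y) ℓ ⟩
    suc p * (suc (value y) * L) + (0 * L + 0)                  ≡⟨ cong₂ (λ q v → suc p * (q * L) + (v * L + 0)) full (sym (value-zeros ℓ)) ⟩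
    suc p * roundLength + (value (zeros ℓ) * L + 0)            ∎)
    where
    open ≡-Reasoning
    L = sweepLength
    full : suc (value y) ≡ 2 ^ ℓ
    full = trans (value-allOnes y ones) (cong (2 ^_) len)
    next-round : ∀ p v ℓ → suc (p * (suc v * (4 + ℓ)) + (v * (4 + ℓ) + (3 + ℓ))) ≡ suc p * (suc v * (4 + ℓ)) + (0 * (4 + ℓ) + 0)
    next-round = solve-∀

  sweep<round : ∀ y s → length y ≡ ℓ → s ≤ 3 + ℓ → value y * sweepLength + s < roundLength
  sweep<round y s len s≤ = begin-strict
    value y * sweepLength + s             <⟨ +-monoʳ-< (value y * sweepLength) (s≤s s≤) ⟩
    value y * sweepLength + sweepLength   ≡⟨ +-comm (value y * sweepLength) sweepLength ⟩
    suc (value y) * sweepLength           ≤⟨ *-monoˡ-≤ sweepLength (subst (λ n → value y < 2 ^ n) len (value<2^length y)) ⟩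
    roundLength                           ∎
    where open ≤-Reasoning

  clock-roundStart : ∀ p → clock (p * roundLength) ≡ ⟨ p , zeros ℓ , 0 ⟩
  clock-roundStart p with clock (p * roundLength) | clock-wellTimed (p * roundLength)
  ... | ⟨ p′ , y , s ⟩ | len , s≤ , N≡
    with quotient-unique p p′ (value y * sweepLength + s) (sweep<round y s len s≤) N≡
  ... | refl , r≡0 with refl ← m+n≡0⇒n≡0 (value y * sweepLength) r≡0 =
    cong (λ y → ⟨ p , y , 0 ⟩) (trans (value≡0⇒zeros y (m*n≡0⇒m≡0 (value y) sweepLength (m+n≡0⇒m≡0 _ r≡0))) (cong zeros len))

  roundStart-time : ∀ N → offset (clock N) ≡ 0 → allZeros (counter (clock N)) ≡ true →
                    N ≡ phase (clock N) * roundLength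
  roundStart-time N s≡0 zs with clock N | clock-wellTimed N
  ... | ⟨ p , y , s ⟩ | _ , _ , N≡ rewrite s≡0 | value-allZeros y zs = trans N≡ (+-identityʳ (p * roundLength))

  roundLength>0 : 0 < roundLength
  roundLength>0 = ≤-trans (s≤s z≤n) (m≤n*m sweepLength (2 ^ ℓ) {{m^n≢0 2 ℓ}})

-- Schemata with ℕ-indexed head predicates; a head index outside the program is read as ⊤.

data Form : Set where
  ⊤'   : Form
  prop : ℕ → Form
  hd   : ℕ → Form
  ¬'   : Form → Form
  _∧'_ : Form → Form → Form
  ◇    : Form → Form

infixr 7 _∧'_
infixr 6 _∨'_
infix  5 _⊕'_ _⇔'_

⊥' : Form
⊥' = ¬' ⊤'

_∨'_ : Form → Form → Form
a ∨' b = ¬' (¬' a ∧' ¬' b)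

_⊕'_ : Form → Form → Form
a ⊕' b = (a ∧' ¬' b) ∨' (¬' a ∧' b)

_⇔'_ : Form → Form → Form
a ⇔' b = ¬' (a ⊕' b)

bitsMatch : List ℕ → (ℕ → Form) → Form
bitsMatch []       g = ⊤'
bitsMatch (p ∷ ps) g = (prop p ⇔' g 0) ∧' bitsMatch ps (g ∘ suc)

eval : (M : Model) → (ℕ → World M → Bool) → Form → World M → Bool
eval M H ⊤'       w = true
eval M H (prop p) w = V M p w
eval M H (hd x)   w = H x w
eval M H (¬' φ)   w = not (eval M H φ w)
eval M H (φ ∧' ψ) w = eval M H φ w ∧ eval M H ψ w
eval M H (◇ φ)    w = anyF (suc (N M)) (λ v → R M w v ∧ eval M H φ v)

size : Form → ℕ
size ⊤'       = 1
size (prop _) = 1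
size (hd _)   = 1
size (¬' φ)   = suc (size φ)
size (φ ∧' ψ) = suc (size φ + size ψ)
size (◇ φ)    = suc (size φ)

SymsIn : SymSet → Form → Set
SymsIn Π ⊤'       = ⊤
SymsIn Π (prop p) = p ∈ elems Π
SymsIn Π (hd _)   = ⊤
SymsIn Π (¬' φ)   = SymsIn Π φ
SymsIn Π (φ ∧' ψ) = SymsIn Π φ × SymsIn Π ψ
SymsIn Π (◇ φ)    = SymsIn Π φ

eval-∨' : ∀ M H a b w → eval M H (a ∨' b) w ≡ eval M H a w ∨ eval M H b w
eval-∨' M H a b w with eval M H a w | eval M H b w
... | true  | _     = refl
... | false | true  = refl
... | false | false = refl

eval-⊕' : ∀ M H a b w → eval M H (a ⊕' b) w ≡ eval M H a w xor eval M H b w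
eval-⊕' M H a b w rewrite eval-∨' M H (a ∧' ¬' b) (¬' a ∧' b) w with eval M H a w | eval M H b w
... | true  | true  = refl
... | true  | false = refl
... | false | true  = refl
... | false | false = refl

eval-bitsMatch : ∀ M H ps g w →
  eval M H (bitsMatch ps g) w ≡ eqBits (map (λ p → V M p w) ps) (applyUpTo (λ i → eval M H (g i) w) (length ps))
eval-bitsMatch M H []       g w = refl
eval-bitsMatch M H (p ∷ ps) g w = cong₂ _∧_ (cong not (eval-⊕' M H (prop p) (g 0) w)) (eval-bitsMatch M H ps (g ∘ suc) w)

size-∨' : ∀ a b → size (a ∨' b) ≡ 4 + size a + size b
size-∨' a b = count (size a) (size b)
  where
  count : ∀ x y → suc (suc (suc x + suc y)) ≡ 4 + x + y
  count = solve-∀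

size-bitsMatch : ∀ ps g → (∀ i → size (g i) ≤ 2) → size (bitsMatch ps g) ≤ 1 + 16 * length ps
size-bitsMatch []       g h = ≤-refl
size-bitsMatch (p ∷ ps) g h = begin
  suc (size (prop p ⇔' g 0) + size (bitsMatch ps (g ∘ suc)))  ≡⟨ cong (λ z → suc (z + size (bitsMatch ps (g ∘ suc)))) (iff (size (g 0))) ⟩
  suc ((11 + 2 * size (g 0)) + size (bitsMatch ps (g ∘ suc)))
    ≤⟨ s≤s (+-mono-≤ (+-monoʳ-≤ 11 (*-monoʳ-≤ 2 (h 0))) (size-bitsMatch ps (g ∘ suc) (h ∘ suc))) ⟩
  suc ((11 + 2 * 2) + (1 + 16 * length ps))                   ≡⟨ count (length ps) ⟩
  1 + 16 * suc (length ps)                                    ∎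
  where
  open ≤-Reasoning
  iff : ∀ y → suc (suc (suc (suc (suc (1 + suc y)) + suc (suc (suc 1 + y))))) ≡ 11 + 2 * y
  iff = solve-∀
  count : ∀ n → suc ((11 + 2 * 2) + (1 + 16 * n)) ≡ 1 + 16 * suc n
  count = solve-∀

SymsIn-bitsMatch : ∀ Π ps g → All (_∈ elems Π) ps → (∀ i → SymsIn Π (g i)) → SymsIn Π (bitsMatch ps g)
SymsIn-bitsMatch Π []       g a        h = tt
SymsIn-bitsMatch Π (p ∷ ps) g (a ∷ as) h =
  ((a , h 0) , (a , h 0)) , SymsIn-bitsMatch Π ps (g ∘ suc) as (h ∘ suc)

toFin? : (K : ℕ) → ℕ → Maybe (Fin K)
toFin? zero    x       = nothing
toFin? (suc K) zero    = just zero
toFin? (suc K) (suc x) = Maybe.map suc (toFin? K x)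

toFin?-toℕ : ∀ K (i : Fin K) → toFin? K (toℕ i) ≡ just i
toFin?-toℕ (suc K) zero    = refl
toFin?-toℕ (suc K) (suc i) rewrite toFin?-toℕ K i = refl

toFin?-< : ∀ K x → x < K → ∃[ i ] (toFin? K x ≡ just i × toℕ i ≡ x)
toFin?-< (suc K) zero    _        = zero , refl , refl
toFin?-< (suc K) (suc x) (s≤s lt) with toFin?-< K x lt
... | i , e , t rewrite e = suc i , refl , cong suc t

compile : (K : ℕ) → Form → MSCFm K
compile K ⊤'       = ⊤'
compile K (prop p) = prop p
compile K (hd x) with toFin? K x
... | just i  = hd i
... | nothing = ⊤'
compile K (¬' φ)   = ¬' (compile K φ)
compile K (φ ∧' ψ) = compile K φ ∧' compile K ψ
compile K (◇ φ)    = ◇ (compile K φ)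

extend : ∀ {K} (M : Model) → (Fin K → World M → Bool) → ℕ → World M → Bool
extend {K} M h x w with toFin? K x
... | just i  = h i w
... | nothing = true

eval-compile : ∀ K (M : Model) (h : Fin K → World M → Bool) φ w →
               mscEval M h (compile K φ) w ≡ eval M (extend M h) φ w
eval-compile K M h ⊤'       w = refl
eval-compile K M h (prop p) w = refl
eval-compile K M h (hd x)   w with toFin? K x
... | just i  = refl
... | nothing = refl
eval-compile K M h (¬' φ)   w = cong not (eval-compile K M h φ w)
eval-compile K M h (φ ∧' ψ) w = cong₂ _∧_ (eval-compile K M h φ w) (eval-compile K M h ψ w)
eval-compile K M h (◇ φ)    w = anyF-cong (suc (N M)) (λ v → cong (R M w v ∧_) (eval-compile K M h φ v))

size-compile : ∀ K φ → mscSizeF (compile K φ) ≡ size φ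
size-compile K ⊤'       = refl
size-compile K (prop p) = refl
size-compile K (hd x) with toFin? K x
... | just i  = refl
... | nothing = refl
size-compile K (¬' φ)   = cong suc (size-compile K φ)
size-compile K (φ ∧' ψ) = cong suc (cong₂ _+_ (size-compile K φ) (size-compile K ψ))
size-compile K (◇ φ)    = cong suc (size-compile K φ)

SymsIn-compile : ∀ Π K φ → SymsIn Π φ → mscSymsIn Π (compile K φ)
SymsIn-compile Π K ⊤'       s = tt
SymsIn-compile Π K (prop p) s = s
SymsIn-compile Π K (hd x)   s with toFin? K x
... | just i  = tt
... | nothing = tt
SymsIn-compile Π K (¬' φ)   s = SymsIn-compile Π K φ s
SymsIn-compile Π K (φ ∧' ψ) (s₁ , s₂) = SymsIn-compile Π K φ s₁ , SymsIn-compile Π K ψ s₂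
SymsIn-compile Π K (◇ φ)    s = SymsIn-compile Π K φ s

sumN : ℕ → (ℕ → ℕ) → ℕ
sumN zero    f = 0
sumN (suc n) f = f 0 + sumN n (f ∘ suc)

sumF-toℕ : ∀ n f → sumF n (f ∘ toℕ) ≡ sumN n f
sumF-toℕ zero    f = refl
sumF-toℕ (suc n) f = cong (f 0 +_) (sumF-toℕ n (f ∘ suc))

sumN-+ : ∀ a b f → sumN (a + b) f ≡ sumN a f + sumN b (λ x → f (a + x))
sumN-+ zero    b f = refl
sumN-+ (suc a) b f = trans (cong (f 0 +_) (sumN-+ a b (f ∘ suc))) (sym (+-assoc (f 0) _ _))

sumN-mono : ∀ n f g → (∀ x → x < n → f x ≤ g x) → sumN n f ≤ sumN n g
sumN-mono zero    f g h = z≤n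
sumN-mono (suc n) f g h = +-mono-≤ (h 0 (s≤s z≤n)) (sumN-mono n (f ∘ suc) (g ∘ suc) (λ x → h (suc x) ∘ s≤s))

sumN-* : ∀ n c f → sumN n (λ x → c * f x) ≡ c * sumN n f
sumN-* zero    c f = sym (*-zeroʳ c)
sumN-* (suc n) c f = trans (cong (c * f 0 +_) (sumN-* n c (f ∘ suc))) (sym (*-distribˡ-+ c (f 0) _))

sumN-≤-* : ∀ n f c → (∀ x → x < n → f x ≤ c) → sumN n f ≤ n * c
sumN-≤-* zero    f c h = z≤n
sumN-≤-* (suc n) f c h = +-mono-≤ (h 0 (s≤s z≤n)) (sumN-≤-* n (f ∘ suc) c (λ x → h (suc x) ∘ s≤s))

module Layout {B A : Set} (width : B → ℕ) where

  widths : List B → ℕ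
  widths []       = 0
  widths (b ∷ bs) = width b + widths bs

  shift : List B → ℕ → ℕ
  shift []       x = x
  shift (b ∷ bs) x = width b + shift bs x

  place : List B → (B → ℕ → A) → A → ℕ → A
  place []       f d x = d
  place (b ∷ bs) f d x = if x <ᵇ width b then f b x else place bs f d (x ∸ width b)

  place-shift : ∀ pre b post f d x → x < width b → place (pre ++ b ∷ post) f d (shift pre x) ≡ f b x
  place-shift []        b post f d x lt rewrite <⇒<ᵇ≡true lt = refl
  place-shift (c ∷ pre) b post f d x lt
    rewrite m+n<ᵇm≡false (width c) (shift pre x) | m+n∸m≡n (width c) (shift pre x) = place-shift pre b post f d x lt

  place-preserves : ∀ (Pr : A → Set) {f d} → Pr d → (∀ b x → Pr (f b x)) → ∀ bs x → Pr (place bs f d x)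
  place-preserves Pr pd pf []       x = pd
  place-preserves Pr pd pf (b ∷ bs) x with x <ᵇ width b
  ... | true  = pf b x
  ... | false = place-preserves Pr pd pf bs (x ∸ width b)

  shift<widths : ∀ pre b post x → x < width b → shift pre x < widths (pre ++ b ∷ post)
  shift<widths []        b post x lt = ≤-trans lt (m≤m+n (width b) (widths post))
  shift<widths (c ∷ pre) b post x lt = +-monoʳ-< (width c) (shift<widths pre b post x lt)

  -- For a concrete list, blockSums unfolds to one sum per block, over the head indices as given by shift.
  blockSums : List B → (ℕ → ℕ) → ℕ
  blockSums []       h = 0
  blockSums (b ∷ bs) h = sumN (width b) h + blockSums bs (λ x → h (width b + x))

  sumN-widths : ∀ bs h → sumN (widths bs) h ≡ blockSums bs h
  sumN-widths []       h = refl
  sumN-widths (b ∷ bs) h = trans (sumN-+ (width b) (widths bs) h) (cong (sumN (width b) h +_) (sumN-widths bs _))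

lookupOr : ∀ {A : Set} → List A → ℕ → A → A
lookupOr []       i       d = d
lookupOr (x ∷ xs) zero    d = x
lookupOr (x ∷ xs) (suc i) d = lookupOr xs i d

module _ {A : Set} where

  lookupOr-++ˡ : ∀ (xs ys : List A) i d → i < length xs → lookupOr (xs ++ ys) i d ≡ lookupOr xs i d
  lookupOr-++ˡ (a ∷ xs) ys zero    d lt       = refl
  lookupOr-++ˡ (a ∷ xs) ys (suc i) d (s≤s lt) = lookupOr-++ˡ xs ys i d lt

  lookupOr-++ʳ : ∀ (xs ys : List A) i d → lookupOr (xs ++ ys) (length xs + i) d ≡ lookupOr ys i d
  lookupOr-++ʳ []       ys i d = refl
  lookupOr-++ʳ (a ∷ xs) ys i d = lookupOr-++ʳ xs ys i d

  All-lookupOr : ∀ {P : A → Set} {xs} → All P xs → ∀ {d} → P d → ∀ i → P (lookupOr xs i d)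
  All-lookupOr []       pd i       = pd
  All-lookupOr (p ∷ ps) pd zero    = p
  All-lookupOr (p ∷ ps) pd (suc i) = All-lookupOr ps pd i

  All-lookupOr< : ∀ {P : A → Set} {xs} → All P xs → ∀ {i} d → i < length xs → P (lookupOr xs i d)
  All-lookupOr< (p ∷ ps) {zero}  d _        = p
  All-lookupOr< (p ∷ ps) {suc i} d (s≤s lt) = All-lookupOr< ps d lt

  sum-map-++ : ∀ (f : A → ℕ) xs ys → sum (map f (xs ++ ys)) ≡ sum (map f xs) + sum (map f ys)
  sum-map-++ f xs ys = trans (cong sum (LP.map-++ f xs ys)) (sum-++ (map f xs) (map f ys))

  sumN-lookupOr : ∀ (xs : List A) d (f : A → ℕ) → sumN (length xs) (λ i → f (lookupOr xs i d)) ≡ sum (map f xs)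
  sumN-lookupOr []       d f = refl
  sumN-lookupOr (x ∷ xs) d f = cong (f x +_) (sumN-lookupOr xs d f)

  offsetOf : ∀ n → (Fin n → List A) → Fin n → ℕ
  offsetOf (suc n) f zero    = 0
  offsetOf (suc n) f (suc j) = length (f zero) + offsetOf n (f ∘ suc) j

  lookupOr-concat : ∀ n (f : Fin n → List A) j i d → i < length (f j) →
                    lookupOr (concat (tabulate f)) (offsetOf n f j + i) d ≡ lookupOr (f j) i d
  lookupOr-concat (suc n) f zero    i d lt = lookupOr-++ˡ (f zero) _ i d lt
  lookupOr-concat (suc n) f (suc j) i d lt = begin
    lookupOr (f zero ++ rest) ((length (f zero) + offsetOf n (f ∘ suc) j) + i) d
      ≡⟨ cong (λ z → lookupOr (f zero ++ rest) z d) (+-assoc (length (f zero)) _ i) ⟩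
    lookupOr (f zero ++ rest) (length (f zero) + (offsetOf n (f ∘ suc) j + i)) d
      ≡⟨ lookupOr-++ʳ (f zero) _ _ d ⟩
    lookupOr (concat (tabulate (f ∘ suc))) (offsetOf n (f ∘ suc) j + i) d
      ≡⟨ lookupOr-concat n (f ∘ suc) j i d lt ⟩
    lookupOr (f (suc j)) i d ∎
    where
    open ≡-Reasoning
    rest = concat (tabulate (f ∘ suc))

  offsetOf+length≤ : ∀ n (f : Fin n → List A) j → offsetOf n f j + length (f j) ≤ length (concat (tabulate f))
  offsetOf+length≤ (suc n) f zero    = ≤-trans (m≤m+n _ _) (≤-reflexive (sym (LP.length-++ (f zero))))
  offsetOf+length≤ (suc n) f (suc j) = begin
    length (f zero) + offsetOf n (f ∘ suc) j + length (f (suc j))  ≡⟨ +-assoc (length (f zero)) _ _ ⟩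
    length (f zero) + (offsetOf n (f ∘ suc) j + length (f (suc j))) ≤⟨ +-monoʳ-≤ (length (f zero)) (offsetOf+length≤ n (f ∘ suc) j) ⟩
    length (f zero) + length (concat (tabulate (f ∘ suc))) ≡⟨ sym (LP.length-++ (f zero)) ⟩
    length (concat (tabulate f)) ∎
    where open ≤-Reasoning

  sum-concat : ∀ n (f : Fin n → List A) (h : A → ℕ) →
               sum (map h (concat (tabulate f))) ≡ sumF n (λ j → sum (map h (f j)))
  sum-concat zero    f h = refl
  sum-concat (suc n) f h = begin
    sum (map h (f zero ++ rest))              ≡⟨ sum-map-++ h (f zero) rest ⟩
    sum (map h (f zero)) + sum (map h rest)   ≡⟨ cong (sum (map h (f zero)) +_) (sum-concat n (f ∘ suc) h) ⟩
    sumF (suc n) (λ j → sum (map h (f j)))    ∎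
    where
    open ≡-Reasoning
    rest = concat (tabulate (f ∘ suc))

-- Terminal clauses have modal depth 0 and no heads, so the last case never matters.

translateTerm : MPFm 0 → Form
translateTerm ⊤'         = ⊤'
translateTerm (prop p)   = prop p
translateTerm (hd ())
translateTerm (¬' φ)     = ¬' (translateTerm φ)
translateTerm (φ ∧' ψ)   = translateTerm φ ∧' translateTerm ψ
translateTerm (◇[ i ] φ) = ⊤'

data Block : Set where
  out reg clk bit carry wrap match rank dia : Block

module Simulation (isId : ℕ → Bool) (Π : SymSet) (P : MPProg) where

  ids : List ℕ
  ids = Π₁ isId Π

  ℓ κ I : ℕ
  ℓ = length ids
  κ = k P
  I = maxIndex P

  open Schedule ℓ public

  -- Every diamond occurrence ◇ᵢ φ in an iteration clause gets its own head.
  diamonds : MPFm κ → List (ℕ × MPFm κ)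
  diamonds ⊤'         = []
  diamonds (prop _)   = []
  diamonds (hd _)     = []
  diamonds (¬' φ)     = diamonds φ
  diamonds (φ ∧' ψ)   = diamonds φ ++ diamonds ψ
  diamonds (◇[ i ] φ) = (i , φ) ∷ []

  diamondsCond : List (MPFm κ × MPFm κ) → MPFm κ → List (ℕ × MPFm κ)
  diamondsCond []             χ = diamonds χ
  diamondsCond ((φ , ψ) ∷ cs) χ = diamonds φ ++ (diamonds ψ ++ diamondsCond cs χ)

  diamondsClause : MPClause κ → List (ℕ × MPFm κ)
  diamondsClause (std ψ)           = diamonds ψ
  diamondsClause (cond (c ∷ cs) χ) = diamondsCond (c ∷ cs) χ

  clauseDiamonds : Fin κ → List (ℕ × MPFm κ)
  clauseDiamonds j = diamondsClause (iter P j)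

  allDiamonds : List (ℕ × MPFm κ)
  allDiamonds = concat (tabulate clauseDiamonds)

  #diamonds : ℕ
  #diamonds = length allDiamonds

  diamondAt : ℕ → ℕ × MPFm κ
  diamondAt g = lookupOr allDiamonds g (1 , ⊤')

  diamondBase : Fin κ → ℕ
  diamondBase = offsetOf κ clauseDiamonds

  -- out: the heads of P, true only at the start of a simulated round (attention and print);
  -- reg: the heads of P in the round being simulated; clk: the position s in a sweep (one-hot);
  -- bit, carry: the ℓ-bit counter of the sweep and its carry chain; wrap: the round ends;
  -- match: the own identifier equals the counter; rank j: more than j successors swept;
  -- dia g: the g-th diamond occurrence holds at a swept successor.
  width : Block → ℕ
  width out   = κ
  width reg   = κ
  width clk   = sweepLength
  width bit   = ℓ
  width carry = suc ℓ
  width wrap  = 1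
  width match = 1
  width rank  = I
  width dia   = #diamonds

  open Layout {A = Form} width public

  internal : List Block
  internal = reg ∷ clk ∷ bit ∷ carry ∷ wrap ∷ match ∷ rank ∷ dia ∷ []

  blocks : List Block
  blocks = out ∷ internal

  before after : Block → List Block
  before out   = []
  before reg   = out ∷ []
  before clk   = out ∷ reg ∷ []
  before bit   = out ∷ reg ∷ clk ∷ []
  before carry = out ∷ reg ∷ clk ∷ bit ∷ []
  before wrap  = out ∷ reg ∷ clk ∷ bit ∷ carry ∷ []
  before match = out ∷ reg ∷ clk ∷ bit ∷ carry ∷ wrap ∷ []
  before rank  = out ∷ reg ∷ clk ∷ bit ∷ carry ∷ wrap ∷ match ∷ []
  before dia   = out ∷ reg ∷ clk ∷ bit ∷ carry ∷ wrap ∷ match ∷ rank ∷ []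
  after out   = internal
  after reg   = clk ∷ bit ∷ carry ∷ wrap ∷ match ∷ rank ∷ dia ∷ []
  after clk   = bit ∷ carry ∷ wrap ∷ match ∷ rank ∷ dia ∷ []
  after bit   = carry ∷ wrap ∷ match ∷ rank ∷ dia ∷ []
  after carry = wrap ∷ match ∷ rank ∷ dia ∷ []
  after wrap  = match ∷ rank ∷ dia ∷ []
  after match = rank ∷ dia ∷ []
  after rank  = dia ∷ []
  after dia   = []

  blocks-split : ∀ b → blocks ≡ before b ++ b ∷ after b
  blocks-split out   = refl
  blocks-split reg   = refl
  blocks-split clk   = refl
  blocks-split bit   = refl
  blocks-split carry = refl
  blocks-split wrap  = refl
  blocks-split match = refl
  blocks-split rank  = refl
  blocks-split dia   = refl

  K : ℕ
  K = widths blocks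

  ix : Block → ℕ → ℕ
  ix b = shift (before b)

  ix<K : ∀ b x → x < width b → ix b x < K
  ix<K b x lt = subst (ix b x <_) (cong widths (sym (blocks-split b))) (shift<widths (before b) b (after b) x lt)

  wrapH matchH : Form
  wrapH  = hd (ix wrap 0)
  matchH = hd (ix match 0)

  atLeast : ℕ → Form
  atLeast zero    = ⊤'
  atLeast (suc j) = hd (ix rank j)

  -- Formulas of modal depth 0 (the argument of a diamond occurrence).
  translate₀ : MPFm κ → Form
  translate₀ ⊤'         = ⊤'
  translate₀ (prop p)   = prop p
  translate₀ (hd j)     = hd (ix reg (toℕ j))
  translate₀ (¬' φ)     = ¬' (translate₀ φ)
  translate₀ (φ ∧' ψ)   = translate₀ φ ∧' translate₀ ψ
  translate₀ (◇[ i ] φ) = ⊤'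

  -- The argument c is the index of the first diamond occurrence of the formula.
  translate : ℕ → MPFm κ → Form
  translate c ⊤'         = ⊤'
  translate c (prop p)   = prop p
  translate c (hd j)     = hd (ix reg (toℕ j))
  translate c (¬' φ)     = ¬' (translate c φ)
  translate c (φ ∧' ψ)   = translate c φ ∧' translate (c + length (diamonds φ)) ψ
  translate c (◇[ i ] φ) = hd (ix dia c)

  translateCond : ℕ → List (MPFm κ × MPFm κ) → MPFm κ → Form
  translateCond c []             χ = translate c χ
  translateCond c ((φ , ψ) ∷ cs) χ =
    (translate c φ ∧' translate c′ ψ) ∨' (¬' (translate c φ) ∧' translateCond (c′ + length (diamonds ψ)) cs χ)
    where c′ = c + length (diamonds φ)

  translateClause : ℕ → MPClause κ → Form
  translateClause c (std ψ)           = translate c ψ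
  translateClause c (cond (x ∷ xs) χ) = translateCond c (x ∷ xs) χ

  update : Fin κ → Form
  update j = translateClause (diamondBase j) (iter P j)

  onFin : (Fin κ → Form) → ℕ → Form
  onFin f x with toFin? κ x
  ... | just j  = f j
  ... | nothing = ⊤'

  -- The i-th neighbour is the matching successor when exactly i - 1 successors were swept before.
  sweepDiamond : ℕ × MPFm κ → Form
  sweepDiamond (i , φ) = hd (ix clk 1) ∧' ◇ (matchH ∧' translate₀ φ) ∧' atLeast (i ∸ 1) ∧' ¬' (atLeast i)

  stepBody : Block → ℕ → Form
  stepBody out   = onFin λ j → wrapH ∧' update j
  stepBody reg   = onFin λ j → (wrapH ∧' update j) ∨' (¬' wrapH ∧' hd (ix reg (toℕ j)))
  stepBody clk zero    = hd (ix clk (3 + ℓ))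
  stepBody clk (suc s) = hd (ix clk s)
  stepBody bit i = hd (ix bit i) ⊕' hd (ix carry (suc i))
  stepBody carry i = if i ≡ᵇ ℓ then hd (ix clk 1) else hd (ix carry (suc i)) ∧' hd (ix bit i)
  stepBody wrap  _ = hd (ix carry 0)
  stepBody match _ = bitsMatch ids (λ i → hd (ix bit i))
  stepBody rank j  = ¬' wrapH ∧' (hd (ix rank j) ∨' hd (ix clk 1) ∧' atLeast j ∧' ◇ matchH)
  stepBody dia g   = ¬' wrapH ∧' (hd (ix dia g) ∨' sweepDiamond (diamondAt g))

  initBody : Block → ℕ → Form
  initBody out   = onFin (translateTerm ∘ term P)
  initBody reg   = onFin (translateTerm ∘ term P)
  initBody clk zero    = ⊤'
  initBody clk (suc _) = ⊥'
  initBody match _ = bitsMatch ids (λ _ → ⊥')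
  initBody _     _ = ⊥'

  stepClause initClause : ℕ → Form
  stepClause = place blocks stepBody ⊤'
  initClause = place blocks initBody ⊤'

  Q : MSCProg
  Q = record
    { k    = K
    ; term = λ i → compile 0 (initClause (toℕ i))
    ; iter = λ i → compile K (stepClause (toℕ i))
    ; att  = att P Vec.++ Vec.replicate (widths internal) false
    ; prn  = prn P Vec.++ Vec.replicate (widths internal) false
    }

  headVal : (M : Model) → ℕ → ℕ → World M → Bool
  headVal M N = extend M (mscRound Q M N)

  headVal-toℕ : ∀ M N (i : Fin K) w → mscRound Q M N i w ≡ headVal M N (toℕ i) w
  headVal-toℕ M N i w rewrite toFin?-toℕ K i = refl

  place-ix : ∀ body b x → x < width b → place blocks body ⊤' (ix b x) ≡ body b x
  place-ix body b x lt = trans (cong (λ bs → place bs body ⊤' (ix b x)) (blocks-split b)) (place-shift (before b) b (after b) body ⊤' x lt)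

  headVal-step : ∀ M N b x w → x < width b → headVal M (suc N) (ix b x) w ≡ eval M (headVal M N) (stepBody b x) w
  headVal-step M N b x w lt with toFin?-< K (ix b x) (ix<K b x lt)
  ... | i , e , toℕi rewrite e = begin
    mscEval M (mscRound Q M N) (compile K (stepClause (toℕ i))) w  ≡⟨ eval-compile K M (mscRound Q M N) (stepClause (toℕ i)) w ⟩
    eval M (headVal M N) (stepClause (toℕ i)) w                     ≡⟨ cong (λ z → eval M (headVal M N) (stepClause z) w) toℕi ⟩
    eval M (headVal M N) (stepClause (ix b x)) w                    ≡⟨ cong (λ φ → eval M (headVal M N) φ w) (place-ix stepBody b x lt) ⟩
    eval M (headVal M N) (stepBody b x) w                           ∎
    where open ≡-Reasoning

  noHeads : ∀ M → Fin 0 → World M → Bool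
  noHeads M ()

  headVal-init : ∀ M b x w → x < width b → headVal M 0 (ix b x) w ≡ eval M (extend M (noHeads M)) (initBody b x) w
  headVal-init M b x w lt with toFin?-< K (ix b x) (ix<K b x lt)
  ... | i , e , toℕi rewrite e = begin
    mscEval M (λ ()) (compile 0 (initClause (toℕ i))) w  ≡⟨ eval-compile 0 M (λ ()) (initClause (toℕ i)) w ⟩
    eval M (extend M (noHeads M)) (initClause (toℕ i)) w      ≡⟨ cong (λ z → eval M (extend M (noHeads M)) (initClause z) w) toℕi ⟩
    eval M (extend M (noHeads M)) (initClause (ix b x)) w     ≡⟨ cong (λ φ → eval M (extend M (noHeads M)) φ w) (place-ix initBody b x lt) ⟩
    eval M (extend M (noHeads M)) (initBody b x) w            ∎
    where open ≡-Reasoning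

  onFin-toℕ : ∀ f (j : Fin κ) → onFin f (toℕ j) ≡ f j
  onFin-toℕ f j rewrite toFin?-toℕ κ j = refl

  module Translation (M : Model) (H : ℕ → World M → Bool) (S : Fin κ → World M → Bool)
                     (H-reg : ∀ (j : Fin κ) v → H (ix reg (toℕ j)) v ≡ S j v) where

    eval-translate₀ : ∀ φ → md φ ≡ 0 → ∀ v → eval M H (translate₀ φ) v ≡ mpEval isId Π M S φ v
    eval-translate₀ ⊤'       e v = refl
    eval-translate₀ (prop p) e v = refl
    eval-translate₀ (hd j)   e v = H-reg j v
    eval-translate₀ (¬' φ)   e v = cong not (eval-translate₀ φ e v)
    eval-translate₀ (φ ∧' ψ) e v = cong₂ _∧_ (eval-translate₀ φ (m⊔n≡0⇒m≡0 e) v) (eval-translate₀ ψ (m⊔n≡0⇒n≡0 e) v)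
      where
      m⊔n≡0⇒m≡0 : md φ ⊔ md ψ ≡ 0 → md φ ≡ 0
      m⊔n≡0⇒m≡0 e = n≤0⇒n≡0 (m⊔n≤o⇒m≤o (md φ) (md ψ) (≤-reflexive e))
      m⊔n≡0⇒n≡0 : md φ ⊔ md ψ ≡ 0 → md ψ ≡ 0
      m⊔n≡0⇒n≡0 e = n≤0⇒n≡0 (m⊔n≤o⇒n≤o (md φ) (md ψ) (≤-reflexive e))

    diamondVal : World M → ℕ × MPFm κ → Bool
    diamondVal w (i , φ) = mpEval isId Π M S (◇[ i ] φ) w

    HoldsFrom : World M → ℕ → List (ℕ × MPFm κ) → Set
    HoldsFrom w c ds = ∀ x → x < length ds → H (ix dia (c + x)) w ≡ diamondVal w (lookupOr ds x (1 , ⊤'))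

    HoldsFrom-++ˡ : ∀ w c ds es → HoldsFrom w c (ds ++ es) → HoldsFrom w c ds
    HoldsFrom-++ˡ w c ds es h x lt =
      trans (h x (<-≤-trans lt (≤-trans (m≤m+n _ _) (≤-reflexive (sym (LP.length-++ ds))))))
            (cong (diamondVal w) (lookupOr-++ˡ ds es x _ lt))

    HoldsFrom-++ʳ : ∀ w c ds es → HoldsFrom w c (ds ++ es) → HoldsFrom w (c + length ds) es
    HoldsFrom-++ʳ w c ds es h x lt = begin
      H (ix dia (c + length ds + x)) w               ≡⟨ cong (λ z → H (ix dia z) w) (+-assoc c (length ds) x) ⟩
      H (ix dia (c + (length ds + x))) w             ≡⟨ h (length ds + x) (subst (length ds + x <_) (sym (LP.length-++ ds)) (+-monoʳ-< (length ds) lt)) ⟩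
      diamondVal w (lookupOr (ds ++ es) (length ds + x) (1 , ⊤')) ≡⟨ cong (diamondVal w) (lookupOr-++ʳ ds es x _) ⟩
      diamondVal w (lookupOr es x (1 , ⊤'))          ∎
      where open ≡-Reasoning

    eval-translate : ∀ w c ψ → HoldsFrom w c (diamonds ψ) → eval M H (translate c ψ) w ≡ mpEval isId Π M S ψ w
    eval-translate w c ⊤'         h = refl
    eval-translate w c (prop p)   h = refl
    eval-translate w c (hd j)     h = H-reg j w
    eval-translate w c (¬' φ)     h = cong not (eval-translate w c φ h)
    eval-translate w c (φ ∧' ψ)   h =
      cong₂ _∧_ (eval-translate w c φ (HoldsFrom-++ˡ w c (diamonds φ) (diamonds ψ) h))
                (eval-translate w (c + length (diamonds φ)) ψ (HoldsFrom-++ʳ w c (diamonds φ) (diamonds ψ) h))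
    eval-translate w c (◇[ i ] φ) h = trans (cong (λ z → H (ix dia z) w) (sym (+-identityʳ c))) (h 0 (s≤s z≤n))

    eval-translateCond : ∀ w c cs χ → HoldsFrom w c (diamondsCond cs χ) →
                         eval M H (translateCond c cs χ) w ≡ condVal isId Π M S cs χ w
    eval-translateCond w c []             χ h = eval-translate w c χ h
    eval-translateCond w c ((φ , ψ) ∷ cs) χ h =
      trans (eval-∨' M H (translate c φ ∧' translate c′ ψ) (¬' (translate c φ) ∧' translateCond c″ cs χ) w)
            (if-then-else-cong (eval-translate w c φ (HoldsFrom-++ˡ w c (diamonds φ) _ h))
                               (eval-translate w c′ ψ (HoldsFrom-++ˡ w c′ (diamonds ψ) _ h′))
                               (eval-translateCond w c″ cs χ (HoldsFrom-++ʳ w c′ (diamonds ψ) _ h′)))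
      where
      c′ = c + length (diamonds φ)
      c″ = c′ + length (diamonds ψ)
      h′ = HoldsFrom-++ʳ w c (diamonds φ) _ h
      if-then-else-cong : ∀ {a a′ b b′ r r′} → a ≡ a′ → b ≡ b′ → r ≡ r′ → (a ∧ b) ∨ (not a ∧ r) ≡ (a′ ∧ b′) ∨ (not a′ ∧ r′)
      if-then-else-cong refl refl refl = refl

    eval-translateClause : ∀ w c cl → HoldsFrom w c (diamondsClause cl) →
                           eval M H (translateClause c cl) w ≡ clauseEval isId Π M S cl w
    eval-translateClause w c (std ψ)           h = eval-translate w c ψ h
    eval-translateClause w c (cond (x ∷ xs) χ) h = eval-translateCond w c (x ∷ xs) χ h

  DiamondOK : ℕ × MPFm κ → Set
  DiamondOK (i , φ) = 1 ≤ i × i ≤ I × md φ ≡ 0 × mpOK Π φ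

  diamonds-OK : ∀ ψ → mpOK Π ψ → md ψ ≤ 1 → maxDia ψ ≤ I → All DiamondOK (diamonds ψ)
  diamonds-OK ⊤'         _         _       _ = []
  diamonds-OK (prop p)   _         _       _ = []
  diamonds-OK (hd j)     _         _       _ = []
  diamonds-OK (¬' ψ)     o         m       x = diamonds-OK ψ o m x
  diamonds-OK (φ ∧' ψ)   (o₁ , o₂) m       x =
    ++⁺ (diamonds-OK φ o₁ (m⊔n≤o⇒m≤o (md φ) (md ψ) m) (m⊔n≤o⇒m≤o (maxDia φ) (maxDia ψ) x))
        (diamonds-OK ψ o₂ (m⊔n≤o⇒n≤o (md φ) (md ψ) m) (m⊔n≤o⇒n≤o (maxDia φ) (maxDia ψ) x))
  diamonds-OK (◇[ i ] φ) (i≥1 , o) (s≤s m) x = (i≥1 , m⊔n≤o⇒m≤o i (maxDia φ) x , n≤0⇒n≡0 m , o) ∷ []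

  CondOK : MPFm κ × MPFm κ → Set
  CondOK (φ , ψ) = mpOK Π φ × md φ ≡ 0 × mpOK Π ψ × md ψ ≤ 1

  diamondsCond-OK : ∀ cs χ → All CondOK cs → mpOK Π χ → md χ ≤ 1 → maxDiaPairs cs ⊔ maxDia χ ≤ I →
                    All DiamondOK (diamondsCond cs χ)
  diamondsCond-OK []             χ _                           o m x = diamonds-OK χ o m (m⊔n≤o⇒n≤o 0 (maxDia χ) x)
  diamondsCond-OK ((φ , ψ) ∷ cs) χ ((o₁ , m₁ , o₂ , m₂) ∷ ok) o m x =
    ++⁺ (diamonds-OK φ o₁ (≤-trans (≤-reflexive m₁) z≤n) (≤-trans (m≤m⊔n (maxDia φ) (maxDia ψ)) φψ≤))
        (++⁺ (diamonds-OK ψ o₂ m₂ (≤-trans (m≤n⊔m (maxDia φ) (maxDia ψ)) φψ≤))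
             (diamondsCond-OK cs χ ok o m (⊔-lub (m⊔n≤o⇒n≤o (maxDia φ ⊔ maxDia ψ) _ head≤) (m⊔n≤o⇒n≤o _ (maxDia χ) x))))
    where
    head≤ : maxDia φ ⊔ maxDia ψ ⊔ maxDiaPairs cs ≤ I
    head≤ = m⊔n≤o⇒m≤o _ (maxDia χ) x
    φψ≤ : maxDia φ ⊔ maxDia ψ ≤ I
    φψ≤ = m⊔n≤o⇒m≤o _ (maxDiaPairs cs) head≤

  diamondsClause-OK : ∀ cl → clauseWF Π cl → maxDiaClause cl ≤ I → All DiamondOK (diamondsClause cl)
  diamondsClause-OK (std ψ)           (o , m)      x = diamonds-OK ψ o m x
  diamondsClause-OK (cond (c ∷ cs) χ) (ok , o , m) x = diamondsCond-OK (c ∷ cs) χ ok o m x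

  allDiamonds-OK : MPWF Π P → All DiamondOK allDiamonds
  allDiamonds-OK wf = concat⁺ (tabulate⁺ λ j → diamondsClause-OK (iter P j) (proj₂ (wf j)) (clause≤I j))
    where
    clause≤I : ∀ j → maxDiaClause (iter P j) ≤ I
    clause≤I j = ≤-trans (m≤n⊔m (maxDia (term P j)) _) (≤-maxF κ (λ i → maxDia (term P i) ⊔ maxDiaClause (iter P i)) j)

  diamondAt-clause : ∀ j x → x < length (clauseDiamonds j) →
                     diamondAt (diamondBase j + x) ≡ lookupOr (clauseDiamonds j) x (1 , ⊤')
  diamondAt-clause j x lt = lookupOr-concat κ clauseDiamonds j x (1 , ⊤') lt

  diamondBase+<#diamonds : ∀ j x → x < length (clauseDiamonds j) → diamondBase j + x < #diamonds
  diamondBase+<#diamonds j x lt = <-≤-trans (+-monoʳ-< (diamondBase j) lt) (offsetOf+length≤ κ clauseDiamonds j)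

  module Tick (M : Model) (N′ : ℕ) where

    H : ℕ → World M → Bool
    H = headVal M N′

    ev : Form → World M → Bool
    ev φ = eval M H φ

    H′ : ℕ → World M → Bool
    H′ = headVal M (suc N′)

    wrapped : World M → Bool
    wrapped = H (ix wrap 0)

    clk1 : World M → Bool
    clk1 = H (ix clk 1)

    tick-out : ∀ j w → H′ (ix out (toℕ j)) w ≡ wrapped w ∧ ev (update j) w
    tick-out j w = trans (headVal-step M N′ out (toℕ j) w (FP.toℕ<n j)) (cong (λ φ → ev φ w) (onFin-toℕ _ j))

    tick-reg : ∀ j w → H′ (ix reg (toℕ j)) w ≡ (wrapped w ∧ ev (update j) w) ∨ (not (wrapped w) ∧ H (ix reg (toℕ j)) w)
    tick-reg j w = trans (headVal-step M N′ reg (toℕ j) w (FP.toℕ<n j))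
                     (trans (cong (λ φ → ev φ w) (onFin-toℕ _ j))
                            (eval-∨' M H (wrapH ∧' update j) (¬' wrapH ∧' hd (ix reg (toℕ j))) w))

    tick-clk : ∀ x → x < sweepLength → ∀ w → H′ (ix clk x) w ≡ ev (stepBody clk x) w
    tick-clk x lt w = headVal-step M N′ clk x w lt

    tick-bit : ∀ i → i < ℓ → ∀ w → H′ (ix bit i) w ≡ H (ix bit i) w xor H (ix carry (suc i)) w
    tick-bit i lt w = trans (headVal-step M N′ bit i w lt) (eval-⊕' M H (hd (ix bit i)) (hd (ix carry (suc i))) w)

    tick-carry-last : ∀ w → H′ (ix carry ℓ) w ≡ clk1 w
    tick-carry-last w = trans (headVal-step M N′ carry ℓ w ≤-refl) (cong (λ b → ev (if b then hd (ix clk 1) else hd (ix carry (suc ℓ)) ∧' hd (ix bit ℓ)) w) (≡ᵇ-refl ℓ))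

    tick-carry : ∀ i → i < ℓ → ∀ w → H′ (ix carry i) w ≡ H (ix carry (suc i)) w ∧ H (ix bit i) w
    tick-carry i lt w =
      trans (headVal-step M N′ carry i w (≤-trans lt (n≤1+n ℓ))) (cong (λ b → ev (if b then hd (ix clk 1) else hd (ix carry (suc i)) ∧' hd (ix bit i)) w) (≢⇒≡ᵇ≡false (<⇒≢ lt)))

    tick-wrap : ∀ w → H′ (ix wrap 0) w ≡ H (ix carry 0) w
    tick-wrap w = headVal-step M N′ wrap 0 w (s≤s z≤n)

    tick-match : ∀ w → H′ (ix match 0) w ≡ eqBits (ID isId Π M w) (applyUpTo (λ i → H (ix bit i) w) ℓ)
    tick-match w = trans (headVal-step M N′ match 0 w (s≤s z≤n)) (eval-bitsMatch M H ids (λ i → hd (ix bit i)) w)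

    tick-rank : ∀ j → j < I → ∀ w →
      H′ (ix rank j) w ≡ not (wrapped w) ∧ (H (ix rank j) w ∨ clk1 w ∧ ev (atLeast j) w ∧ ev (◇ matchH) w)
    tick-rank j lt w = trans (headVal-step M N′ rank j w lt)
      (cong (not (wrapped w) ∧_) (eval-∨' M H (hd (ix rank j)) (hd (ix clk 1) ∧' atLeast j ∧' ◇ matchH) w))

    tick-dia : ∀ g → g < #diamonds → ∀ w →
      H′ (ix dia g) w ≡ not (wrapped w) ∧ (H (ix dia g) w ∨ ev (sweepDiamond (diamondAt g)) w)
    tick-dia g lt w = trans (headVal-step M N′ dia g w lt)
      (cong (not (wrapped w) ∧_) (eval-∨' M H (hd (ix dia g)) (sweepDiamond (diamondAt g)) w))

  eval-translateTerm : ∀ M H (φ : MPFm 0) w → md φ ≡ 0 → eval M H (translateTerm φ) w ≡ mpEval isId Π M (λ ()) φ w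
  eval-translateTerm M H ⊤'       w e = refl
  eval-translateTerm M H (prop p) w e = refl
  eval-translateTerm M H (¬' φ)   w e = cong not (eval-translateTerm M H φ w e)
  eval-translateTerm M H (φ ∧' ψ) w e =
    cong₂ _∧_ (eval-translateTerm M H φ w (n≤0⇒n≡0 (m⊔n≤o⇒m≤o (md φ) (md ψ) (≤-reflexive e))))
              (eval-translateTerm M H ψ w (n≤0⇒n≡0 (m⊔n≤o⇒n≤o (md φ) (md ψ) (≤-reflexive e))))

  module Run (M : Model) (wf : MPWF Π P) (hid : HasIds isId Π M) where

    ∣W∣ : ℕ
    ∣W∣ = suc (N M)

    idOf : World M → List Bool
    idOf = ID isId Π M

    length-idOf : ∀ u → length (idOf u) ≡ ℓ
    length-idOf u = LP.length-map (λ p → V M p u) ids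

    -- In the sweep for y the successors with identifier < y count as swept; from offset 2 on,
    -- so does the one with identifier y, which is matched at offset 1.
    Swept : ℕ → List Bool → List Bool → Bool
    Swept s x y = if s ≤ᵇ 1 then lexLt x y else lexLe x y

    #below : List Bool → World M → ℕ
    #below y w = countF ∣W∣ (λ u → R M w u ∧ lexLt (idOf u) y)

    #swept : ℕ → List Bool → World M → ℕ
    #swept s y w = countF ∣W∣ (λ u → R M w u ∧ Swept s (idOf u) y)

    -- The counter is incremented by a carry travelling from the last bit to the first
    -- at offsets 2, …, 2 + ℓ.
    counterBit : ℕ → List Bool → ℕ → Bool
    counterBit s y i = bitAt y i xor (allOnes (drop (suc i) y) ∧ (2 + ℓ ≤ᵇ s + i))

    carryBit : ℕ → List Bool → ℕ → Bool
    carryBit s y i = allOnes (drop i y) ∧ (s + i ≡ᵇ 2 + ℓ)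

    sweptDiamond : (Fin κ → World M → Bool) → ℕ → List Bool → ℕ × MPFm κ → World M → Bool
    sweptDiamond S s y (i , φ) w =
      anyF ∣W∣ (λ v → R M w v ∧ (Swept s (idOf v) y ∧ (mpEval isId Π M S φ v ∧ (suc (#below (idOf v) w) ≡ᵇ i))))

    -- Q at round N′ is at offset s of the sweep for y, simulating the round of P with heads S.
    record Invariant (N′ : ℕ) (S : Fin κ → World M → Bool) (s : ℕ) (y : List Bool) : Set where
      field
        s≤3+ℓ    : s ≤ 3 + ℓ
        length-y : length y ≡ ℓ
        at-out   : ∀ j w → headVal M N′ (ix out (toℕ j)) w ≡ ((s ≡ᵇ 0) ∧ allZeros y) ∧ S j w
        at-reg   : ∀ j w → headVal M N′ (ix reg (toℕ j)) w ≡ S j w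
        at-clk   : ∀ x → x < sweepLength → ∀ w → headVal M N′ (ix clk x) w ≡ (x ≡ᵇ s)
        at-bit   : ∀ i → i < ℓ → ∀ w → headVal M N′ (ix bit i) w ≡ counterBit s y i
        at-carry : ∀ i → i < suc ℓ → ∀ w → headVal M N′ (ix carry i) w ≡ carryBit s y i
        at-wrap  : ∀ w → headVal M N′ (ix wrap 0) w ≡ allOnes y ∧ (s ≡ᵇ 3 + ℓ)
        at-match : ∀ w → headVal M N′ (ix match 0) w ≡ eqBits (idOf w) (applyUpTo (counterBit (pred s) y) ℓ)
        at-rank  : ∀ j → j < I → ∀ w → headVal M N′ (ix rank j) w ≡ (suc j ≤ᵇ #swept s y w)
        at-dia   : ∀ g → g < #diamonds → ∀ w → headVal M N′ (ix dia g) w ≡ sweptDiamond S s y (diamondAt g) w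

    counterBit-early : ∀ s y i → i < ℓ → s ≤ 2 → counterBit s y i ≡ bitAt y i
    counterBit-early s y i lt s≤2
      rewrite >⇒≤ᵇ≡false {2 + ℓ} {s + i} (≤-trans (≤-reflexive (sym (+-suc s i))) (+-mono-≤ s≤2 lt))
      = trans (cong (bitAt y i xor_) (∧-zeroʳ _)) (xor-identityʳ (bitAt y i))

    counter-start : ∀ y → length y ≡ ℓ → applyUpTo (counterBit 0 y) ℓ ≡ y
    counter-start y len = begin
      applyUpTo (counterBit 0 y) ℓ  ≡⟨ applyUpTo-cong ℓ _ _ (λ i lt → counterBit-early 0 y i lt z≤n) ⟩
      applyUpTo (bitAt y) ℓ         ≡⟨ cong (applyUpTo (bitAt y)) (sym len) ⟩
      applyUpTo (bitAt y) (length y) ≡⟨ applyUpTo-bitAt y ⟩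
      y                              ∎
      where open ≡-Reasoning

    #below-zeros : ∀ w → #below (zeros ℓ) w ≡ 0
    #below-zeros w = countF-false ∣W∣ _ (λ u → trans (cong (R M w u ∧_) (lexLt-zeros (idOf u) ℓ)) (∧-zeroʳ _))

    sweptDiamond-start : ∀ S q w → sweptDiamond S 0 (zeros ℓ) q w ≡ false
    sweptDiamond-start S (i , φ) w = anyF-false ∣W∣ _ (λ v →
      trans (cong (λ b → R M w v ∧ (b ∧ (mpEval isId Π M S φ v ∧ (suc (#below (idOf v) w) ≡ᵇ i)))) (lexLt-zeros (idOf v) ℓ))
            (∧-zeroʳ (R M w v)))

    invariant-start : Invariant 0 (mpRound isId Π P M 0) 0 (zeros ℓ)
    invariant-start = record
      { s≤3+ℓ    = z≤n
      ; length-y = LP.length-replicate ℓ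
      ; at-out   = λ j w → trans (init out (toℕ j) (FP.toℕ<n j) w)
                             (trans (terminal j w) (cong (_∧ mpRound isId Π P M 0 j w) (sym (allZeros-zeros ℓ))))
      ; at-reg   = λ j w → trans (init reg (toℕ j) (FP.toℕ<n j) w) (terminal j w)
      ; at-clk   = λ { zero lt w → init clk 0 lt w ; (suc x) lt w → init clk (suc x) lt w }
      ; at-bit   = λ i lt w → trans (init bit i lt w) (sym (trans (counterBit-early 0 (zeros ℓ) i lt z≤n) (bitAt-zeros ℓ i)))
      ; at-carry = λ i lt w → trans (init carry i lt w)
                               (sym (trans (cong (allOnes (drop i (zeros ℓ)) ∧_) (≢⇒≡ᵇ≡false (λ e → <⇒≢ (≤-trans lt (n≤1+n _)) e)))
                                           (∧-zeroʳ _)))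
      ; at-wrap  = λ w → trans (init wrap 0 (s≤s z≤n) w) (sym (∧-zeroʳ _))
      ; at-match = λ w → trans (init match 0 (s≤s z≤n) w)
                           (trans (eval-bitsMatch M (extend M (noHeads M)) ids (λ _ → ⊥') w)
                             (cong (eqBits (idOf w)) (applyUpTo-cong ℓ _ _ (λ i lt →
                               sym (trans (counterBit-early 0 (zeros ℓ) i lt z≤n) (bitAt-zeros ℓ i))))))
      ; at-rank  = λ j lt w → trans (init rank j lt w) (sym (cong (suc j ≤ᵇ_) (#below-zeros w)))
      ; at-dia   = λ g lt w → trans (init dia g lt w) (sym (sweptDiamond-start _ (diamondAt g) w))
      }
      where
      init : ∀ b x → x < width b → ∀ w → headVal M 0 (ix b x) w ≡ eval M (extend M (noHeads M)) (initBody b x) w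
      init b x lt w = headVal-init M b x w lt
      terminal : ∀ j w → eval M (extend M (noHeads M)) (onFin (translateTerm ∘ term P) (toℕ j)) w ≡ mpRound isId Π P M 0 j w
      terminal j w rewrite onFin-toℕ (translateTerm ∘ term P) j = eval-translateTerm M _ (term P j) w (proj₂ (proj₁ (wf j)))

    counterBit-suc : ∀ s y i → counterBit s y i xor carryBit s y (suc i) ≡ counterBit (suc s) y i
    counterBit-suc s y i = begin
      (bitAt y i xor (A ∧ (2 + ℓ ≤ᵇ s + i))) xor (A ∧ (s + suc i ≡ᵇ 2 + ℓ))
        ≡⟨ xor-assoc (bitAt y i) _ _ ⟩
      bitAt y i xor ((A ∧ (2 + ℓ ≤ᵇ s + i)) xor (A ∧ (s + suc i ≡ᵇ 2 + ℓ)))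
        ≡⟨ cong (bitAt y i xor_) (sym (∧-distribˡ-xor A _ _)) ⟩
      bitAt y i xor (A ∧ ((2 + ℓ ≤ᵇ s + i) xor (s + suc i ≡ᵇ 2 + ℓ)))
        ≡⟨ cong (λ z → bitAt y i xor (A ∧ ((2 + ℓ ≤ᵇ s + i) xor (z ≡ᵇ 2 + ℓ)))) (+-suc s i) ⟩
      bitAt y i xor (A ∧ ((2 + ℓ ≤ᵇ s + i) xor (suc (s + i) ≡ᵇ 2 + ℓ)))
        ≡⟨ cong (λ z → bitAt y i xor (A ∧ z)) (sym (≤ᵇ-suc (2 + ℓ) (s + i))) ⟩
      bitAt y i xor (A ∧ (2 + ℓ ≤ᵇ suc (s + i)))
        ∎
      where
      open ≡-Reasoning
      A = allOnes (drop (suc i) y)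

    carryBit-suc : ∀ s y i → i < length y → carryBit s y (suc i) ∧ counterBit s y i ≡ carryBit (suc s) y i
    carryBit-suc s y i lt rewrite +-suc s i | allOnes-drop y i lt with suc (s + i) ≡ᵇ 2 + ℓ in e
    ... | false = trans (cong (_∧ counterBit s y i) (∧-zeroʳ _)) (sym (∧-zeroʳ _))
    ... | true rewrite >⇒≤ᵇ≡false {2 + ℓ} {s + i} (≤-reflexive (≡ᵇ⇒≡′ e))
      with bitAt y i | allOnes (drop (suc i) y)
    ...   | true  | true  = refl
    ...   | true  | false = refl
    ...   | false | true  = refl
    ...   | false | false = refl

    -- Identifiers are unique, so at most one successor matches y.
    #lexLe≡#below+match : ∀ y w →
      countF ∣W∣ (λ u → R M w u ∧ lexLe (idOf u) y) ≡ #below y w + fromBool (anyF ∣W∣ (λ u → R M w u ∧ eqBits (idOf u) y))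
    #lexLe≡#below+match y w =
      trans (countF-cong ∣W∣ (λ u → ∧-distribˡ-∨ (R M w u) (lexLt (idOf u) y) (eqBits (idOf u) y)))
        (trans (countF-∨-disjoint ∣W∣ (λ u → R M w u ∧ lexLt (idOf u) y) (λ u → R M w u ∧ eqBits (idOf u) y) disjoint)
               (cong (#below y w +_) (countF-unique ∣W∣ _ unique)))
      where
      disjoint : ∀ u → (R M w u ∧ lexLt (idOf u) y) ∧ (R M w u ∧ eqBits (idOf u) y) ≡ false
      disjoint u with eqBits (idOf u) y in e
      ... | false = trans (cong ((R M w u ∧ lexLt (idOf u) y) ∧_) (∧-zeroʳ (R M w u))) (∧-zeroʳ _)
      ... | true rewrite eqBits⇒≡ (idOf u) y e | lexLt-irrefl y = cong (_∧ (R M w u ∧ true)) (∧-zeroʳ (R M w u))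
      unique : ∀ u v → R M w u ∧ eqBits (idOf u) y ≡ true → R M w v ∧ eqBits (idOf v) y ≡ true → u ≡ v
      unique u v a b = hid u v (trans (eqBits⇒≡ _ _ (second a)) (sym (eqBits⇒≡ _ _ (second b))))
        where
        second : ∀ {x z} → x ∧ z ≡ true → z ≡ true
        second {true} e = e

    module Sweep (N′ : ℕ) (S : Fin κ → World M → Bool) (s : ℕ) (y : List Bool) (inv : Invariant N′ S s y) where
      open Invariant inv
      open Tick M N′
      open Translation M H S at-reg

      matching : World M → List Bool → Bool
      matching w z = anyF ∣W∣ (λ v → R M w v ∧ eqBits (idOf v) z)

      atLeast-val : ∀ j → j ≤ I → ∀ w → ev (atLeast j) w ≡ (j ≤ᵇ #swept s y w)
      atLeast-val zero    _  w = refl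
      atLeast-val (suc j) le w = at-rank j le w

      -- The rank and diamond heads only change at offset 1, when the successor
      -- with identifier y (if any) is swept.
      rank-sweep : ∀ s′ j w →
        ((suc j ≤ᵇ #swept s′ y w) ∨ (1 ≡ᵇ s′) ∧ (j ≤ᵇ #swept s′ y w) ∧ matching w (applyUpTo (counterBit (pred s′) y) ℓ))
          ≡ (suc j ≤ᵇ #swept (suc s′) y w)
      rank-sweep zero          j w = ∨-identityʳ _
      rank-sweep (suc (suc _)) j w = ∨-identityʳ _
      rank-sweep (suc zero)    j w rewrite counter-start y length-y = begin
        (suc j ≤ᵇ #below y w) ∨ (j ≤ᵇ #below y w) ∧ matching w y    ≡⟨ sym (≤ᵇ-+-fromBool j (#below y w) (matching w y)) ⟩
        (suc j ≤ᵇ #below y w + fromBool (matching w y))              ≡⟨ cong (suc j ≤ᵇ_) (sym (#lexLe≡#below+match y w)) ⟩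
        (suc j ≤ᵇ #swept 2 y w)                                      ∎
        where open ≡-Reasoning

      dia-sweep : ∀ s′ i φ w → 1 ≤ i →
        (sweptDiamond S s′ y (i , φ) w ∨
           (1 ≡ᵇ s′) ∧ anyF ∣W∣ (λ v → R M w v ∧ (eqBits (idOf v) (applyUpTo (counterBit (pred s′) y) ℓ) ∧ mpEval isId Π M S φ v))
                     ∧ (i ∸ 1 ≤ᵇ #swept s′ y w) ∧ not (i ≤ᵇ #swept s′ y w))
          ≡ sweptDiamond S (suc s′) y (i , φ) w
      dia-sweep zero          i φ w _   = ∨-identityʳ _
      dia-sweep (suc (suc _)) i φ w _   = ∨-identityʳ _
      dia-sweep (suc zero)    i φ w i≥1 rewrite counter-start y length-y = sym (begin
        anyF ∣W∣ (λ v → R M w v ∧ (lexLe (idOf v) y ∧ (φ′ v ∧ isIth v)))  ≡⟨ anyF-cong ∣W∣ split ⟩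
        anyF ∣W∣ (λ v → below v ∨ at v ∧ isIth-y)                          ≡⟨ anyF-∨ ∣W∣ below (λ v → at v ∧ isIth-y) ⟩
        anyF ∣W∣ below ∨ anyF ∣W∣ (λ v → at v ∧ isIth-y)                   ≡⟨ cong (anyF ∣W∣ below ∨_) (anyF-∧ʳ ∣W∣ at isIth-y) ⟩
        anyF ∣W∣ below ∨ anyF ∣W∣ at ∧ isIth-y
          ≡⟨ cong (λ b → anyF ∣W∣ below ∨ anyF ∣W∣ at ∧ b) (suc≡ᵇ⇔between i (#below y w) i≥1) ⟩
        anyF ∣W∣ below ∨ anyF ∣W∣ at ∧ (i ∸ 1 ≤ᵇ #below y w) ∧ not (i ≤ᵇ #below y w) ∎)
        where
        open ≡-Reasoning
        φ′ : World M → Bool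
        φ′ = mpEval isId Π M S φ
        isIth : World M → Bool
        isIth v = suc (#below (idOf v) w) ≡ᵇ i
        isIth-y : Bool
        isIth-y = suc (#below y w) ≡ᵇ i
        below at : World M → Bool
        below v = R M w v ∧ (lexLt (idOf v) y ∧ (φ′ v ∧ isIth v))
        at v    = R M w v ∧ (eqBits (idOf v) y ∧ φ′ v)
        split : ∀ v → R M w v ∧ (lexLe (idOf v) y ∧ (φ′ v ∧ isIth v)) ≡ below v ∨ at v ∧ isIth-y
        split v with eqBits (idOf v) y in e
        ... | false = no-match (R M w v) (lexLt (idOf v) y)
          where
          no-match : ∀ r l → r ∧ ((l ∨ false) ∧ (φ′ v ∧ isIth v)) ≡ r ∧ (l ∧ (φ′ v ∧ isIth v)) ∨ (r ∧ (false ∧ φ′ v)) ∧ isIth-y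
          no-match true  true  = sym (∨-identityʳ _)
          no-match true  false = refl
          no-match false l     = refl
        ... | true rewrite eqBits⇒≡ (idOf v) y e | lexLt-irrefl y = matched (R M w v) (φ′ v)
          where
          matched : ∀ r p → r ∧ (true ∧ (p ∧ isIth-y)) ≡ r ∧ (false ∧ (p ∧ isIth-y)) ∨ (r ∧ (true ∧ p)) ∧ isIth-y
          matched true  p = refl
          matched false p = refl

      rank-next : ∀ j → j < I → ∀ w → H′ (ix rank j) w ≡ not (wrapped w) ∧ (suc j ≤ᵇ #swept (suc s) y w)
      rank-next j lt w = trans (tick-rank j lt w) (cong (not (wrapped w) ∧_) (trans values (rank-sweep s j w)))
        where
        values : H (ix rank j) w ∨ clk1 w ∧ ev (atLeast j) w ∧ ev (◇ matchH) w
               ≡ (suc j ≤ᵇ #swept s y w) ∨ (1 ≡ᵇ s) ∧ (j ≤ᵇ #swept s y w) ∧ matching w (applyUpTo (counterBit (pred s) y) ℓ)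
        values = cong₂ _∨_ (at-rank j lt w)
                   (cong₂ _∧_ (at-clk 1 (s≤s (s≤s z≤n)) w)
                     (cong₂ _∧_ (atLeast-val j (<⇒≤ lt) w) (anyF-cong ∣W∣ (λ v → cong (R M w v ∧_) (at-match v)))))

      dia-next : ∀ g → g < #diamonds → ∀ w → H′ (ix dia g) w ≡ not (wrapped w) ∧ sweptDiamond S (suc s) y (diamondAt g) w
      dia-next g lt w with All-lookupOr< (allDiamonds-OK wf) (1 , ⊤') lt
      ... | i≥1 , i≤I , md≡0 , _ =
        trans (tick-dia g lt w)
          (cong (not (wrapped w) ∧_) (trans (cong₂ _∨_ (at-dia g lt w) values) (dia-sweep s i φ w i≥1)))
        where
        i = proj₁ (diamondAt g)
        φ = proj₂ (diamondAt g)
        values : ev (sweepDiamond (diamondAt g)) w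
               ≡ (1 ≡ᵇ s) ∧ anyF ∣W∣ (λ v → R M w v ∧ (eqBits (idOf v) (applyUpTo (counterBit (pred s) y) ℓ) ∧ mpEval isId Π M S φ v))
                          ∧ (i ∸ 1 ≤ᵇ #swept s y w) ∧ not (i ≤ᵇ #swept s y w)
        values = cong₂ _∧_ (at-clk 1 (s≤s (s≤s z≤n)) w)
                   (cong₂ _∧_ (anyF-cong ∣W∣ (λ v → cong (R M w v ∧_) (cong₂ _∧_ (at-match v) (eval-translate₀ φ md≡0 v))))
                     (cong₂ (λ a b → a ∧ not b) (atLeast-val (i ∸ 1) (≤-trans (m∸n≤m i 1) i≤I) w) (atLeast-val i i≤I w)))

      match-next : ∀ w → H′ (ix match 0) w ≡ eqBits (idOf w) (applyUpTo (counterBit s y) ℓ)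
      match-next w = trans (tick-match w) (cong (eqBits (idOf w)) (applyUpTo-cong ℓ _ _ (λ i lt → at-bit i lt w)))

      bit-next : ∀ i → i < ℓ → ∀ w → H′ (ix bit i) w ≡ counterBit s y i xor carryBit s y (suc i)
      bit-next i lt w = trans (tick-bit i lt w) (cong₂ _xor_ (at-bit i lt w) (at-carry (suc i) (s≤s lt) w))

      module _ (s<3+ℓ : s < 3 + ℓ) where

        not-wrapped : ∀ w → wrapped w ≡ false
        not-wrapped w = trans (at-wrap w) (trans (cong (allOnes y ∧_) (≢⇒≡ᵇ≡false (<⇒≢ s<3+ℓ))) (∧-zeroʳ _))

        clk-mid : ∀ x → x < sweepLength → ∀ w → H′ (ix clk x) w ≡ (x ≡ᵇ suc s)
        clk-mid zero    lt w = trans (tick-clk 0 lt w) (trans (at-clk (3 + ℓ) ≤-refl w) (≢⇒≡ᵇ≡false (λ e → <⇒≢ s<3+ℓ (sym e))))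
        clk-mid (suc x) lt w = trans (tick-clk (suc x) lt w) (at-clk x (<-trans (n<1+n x) lt) w)

        carry-mid : ∀ i → i < suc ℓ → ∀ w → H′ (ix carry i) w ≡ carryBit (suc s) y i
        carry-mid i (s≤s i≤ℓ) w with m≤n⇒m<n∨m≡n i≤ℓ
        ... | inj₂ refl = begin
          H′ (ix carry ℓ) w                          ≡⟨ tick-carry-last w ⟩
          clk1 w                                     ≡⟨ at-clk 1 (s≤s (s≤s z≤n)) w ⟩
          (1 ≡ᵇ s)                                   ≡⟨ ≡ᵇ-cong (λ e → cong (_+ ℓ) (sym e)) (λ e → sym (+-cancelʳ-≡ ℓ s 1 e)) ⟩
          (s + ℓ ≡ᵇ 1 + ℓ)                           ≡⟨ cong (λ ys → allOnes ys ∧ (suc s + ℓ ≡ᵇ 2 + ℓ)) (sym drop-ℓ) ⟩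
          carryBit (suc s) y ℓ                       ∎
          where
          open ≡-Reasoning
          drop-ℓ : drop ℓ y ≡ []
          drop-ℓ = trans (cong (λ n → drop n y) (sym length-y)) (drop-length y)
        ... | inj₁ i<ℓ =
          trans (tick-carry i i<ℓ w)
            (trans (cong₂ _∧_ (at-carry (suc i) (s≤s i<ℓ) w) (at-bit i i<ℓ w))
                   (carryBit-suc s y i (subst (i <_) (sym length-y) i<ℓ)))

        invariant-mid : Invariant (suc N′) S (suc s) y
        invariant-mid = record
          { s≤3+ℓ    = s<3+ℓ
          ; length-y = length-y
          ; at-out   = λ j w → trans (tick-out j w) (cong (_∧ ev (update j) w) (not-wrapped w))
          ; at-reg   = λ j w → trans (tick-reg j w)
                                 (trans (cong (λ b → (b ∧ ev (update j) w) ∨ (not b ∧ H (ix reg (toℕ j)) w)) (not-wrapped w))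
                                        (at-reg j w))
          ; at-clk   = clk-mid
          ; at-bit   = λ i lt w → trans (bit-next i lt w) (counterBit-suc s y i)
          ; at-carry = carry-mid
          ; at-wrap  = λ w → trans (tick-wrap w) (trans (at-carry 0 (s≤s z≤n) w) (cong (λ z → allOnes y ∧ (z ≡ᵇ 2 + ℓ)) (+-identityʳ s)))
          ; at-match = match-next
          ; at-rank  = λ j lt w → trans (rank-next j lt w) (cong (λ b → not b ∧ _) (not-wrapped w))
          ; at-dia   = λ g lt w → trans (dia-next g lt w) (cong (λ b → not b ∧ _) (not-wrapped w))
          }

    module SweepEnd (N′ : ℕ) (S : Fin κ → World M → Bool) (y : List Bool) (inv : Invariant N′ S (3 + ℓ) y) where
      open Invariant inv
      open Tick M N′
      open Sweep N′ S (3 + ℓ) y inv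
      open Translation M H S at-reg

      wrapped-end : ∀ w → wrapped w ≡ allOnes y
      wrapped-end w = trans (at-wrap w) (trans (cong (allOnes y ∧_) (≡ᵇ-refl (3 + ℓ))) (∧-identityʳ _))

      length-increment-y : length (increment y) ≡ ℓ
      length-increment-y = trans (length-increment y) length-y

      counterBit-end : ∀ i → i < ℓ → counterBit (3 + ℓ) y i ≡ counterBit 0 (increment y) i
      counterBit-end i lt = begin
        bitAt y i xor (allOnes (drop (suc i) y) ∧ (2 + ℓ ≤ᵇ 3 + ℓ + i))
          ≡⟨ cong (λ b → bitAt y i xor (allOnes (drop (suc i) y) ∧ b)) (≤⇒≤ᵇ≡true (≤-trans (n≤1+n _) (m≤m+n (3 + ℓ) i))) ⟩
        bitAt y i xor (allOnes (drop (suc i) y) ∧ true)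
          ≡⟨ cong (bitAt y i xor_) (∧-identityʳ _) ⟩
        bitAt y i xor allOnes (drop (suc i) y)
          ≡⟨ sym (bitAt-increment y i (subst (i <_) (sym length-y) lt)) ⟩
        bitAt (increment y) i
          ≡⟨ sym (counterBit-early 0 (increment y) i lt z≤n) ⟩
        counterBit 0 (increment y) i
          ∎
        where open ≡-Reasoning

      carry-off : ∀ i → carryBit (3 + ℓ) y (suc i) ≡ false
      carry-off i = trans (cong (allOnes (drop (suc i) y) ∧_) (≢⇒≡ᵇ≡false (λ e → <⇒≢ (m≤m+n (3 + ℓ) (suc i)) (sym e)))) (∧-zeroʳ _)

      clk-end : ∀ x → x < sweepLength → ∀ w → H′ (ix clk x) w ≡ (x ≡ᵇ 0)
      clk-end zero    lt       w = trans (tick-clk 0 lt w) (trans (at-clk (3 + ℓ) ≤-refl w) (≡ᵇ-refl (3 + ℓ)))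
      clk-end (suc x) lt w = trans (tick-clk (suc x) lt w) (trans (at-clk x (<-trans (n<1+n x) lt) w) (≢⇒≡ᵇ≡false (<⇒≢ (≤-pred lt))))

      bit-end : ∀ i → i < ℓ → ∀ w → H′ (ix bit i) w ≡ counterBit 0 (increment y) i
      bit-end i lt w = trans (bit-next i lt w) (trans (cong (counterBit (3 + ℓ) y i xor_) (carry-off i))
                                                      (trans (xor-identityʳ _) (counterBit-end i lt)))

      carry-end : ∀ i → i < suc ℓ → ∀ w → H′ (ix carry i) w ≡ carryBit 0 (increment y) i
      carry-end i (s≤s i≤ℓ) w = trans (carry-false i≤ℓ) (sym (trans (cong (allOnes (drop i (increment y)) ∧_) i≢2+ℓ) (∧-zeroʳ _)))
        where
        i≢2+ℓ : (i ≡ᵇ 2 + ℓ) ≡ false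
        i≢2+ℓ = ≢⇒≡ᵇ≡false (<⇒≢ (≤-trans (s≤s i≤ℓ) (n≤1+n _)))
        carry-false : i ≤ ℓ → H′ (ix carry i) w ≡ false
        carry-false i≤ℓ with m≤n⇒m<n∨m≡n i≤ℓ
        ... | inj₂ refl = trans (tick-carry-last w) (at-clk 1 (s≤s (s≤s z≤n)) w)
        ... | inj₁ i<ℓ  = trans (tick-carry i i<ℓ w) (cong (_∧ H (ix bit i) w) (trans (at-carry (suc i) (s≤s i<ℓ) w) (carry-off i)))

      wrap-end : ∀ w → H′ (ix wrap 0) w ≡ allOnes (increment y) ∧ (0 ≡ᵇ 3 + ℓ)
      wrap-end w = trans (tick-wrap w) (trans (at-carry 0 (s≤s z≤n) w)
                     (trans (cong (allOnes y ∧_) (≢⇒≡ᵇ≡false (λ e → <⇒≢ (m≤m+n (3 + ℓ) 0) (sym e))))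
                            (trans (∧-zeroʳ _) (sym (∧-zeroʳ _)))))

      match-end : ∀ w → H′ (ix match 0) w ≡ eqBits (idOf w) (applyUpTo (counterBit 0 (increment y)) ℓ)
      match-end w = trans (match-next w) (cong (eqBits (idOf w)) (applyUpTo-cong ℓ _ _ (λ i lt → counterBit-end i lt)))

      stepP : Fin κ → World M → Bool
      stepP j = clauseEval isId Π M S (iter P j)

      -- After the last sweep every successor has been swept, so the dia heads hold
      -- the values of the diamond occurrences.
      sweptDiamond-complete : allOnes y ≡ true → ∀ q w → sweptDiamond S (3 + ℓ) y q w ≡ diamondVal w q
      sweptDiamond-complete ones (i , φ) w = anyF-cong ∣W∣ λ v →
        trans (cong (λ b → R M w v ∧ (b ∧ (mpEval isId Π M S φ v ∧ (suc (#below (idOf v) w) ≡ᵇ i))))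
                    (lexLe-allOnes (idOf v) y (trans (length-idOf v) (sym length-y)) ones))
              (rearrange (R M w v) (mpEval isId Π M S φ v) (suc (#below (idOf v) w) ≡ᵇ i))
        where
        rearrange : ∀ r p c → r ∧ (true ∧ (p ∧ c)) ≡ (r ∧ c) ∧ p
        rearrange true true  c = sym (∧-identityʳ c)
        rearrange true false c = sym (∧-zeroʳ c)
        rearrange false p    c = refl

      update-correct : allOnes y ≡ true → ∀ j w → ev (update j) w ≡ stepP j w
      update-correct ones j w = eval-translateClause w (diamondBase j) (iter P j) λ x lt → begin
        H (ix dia (diamondBase j + x)) w                                ≡⟨ at-dia _ (diamondBase+<#diamonds j x lt) w ⟩
        sweptDiamond S (3 + ℓ) y (diamondAt (diamondBase j + x)) w      ≡⟨ cong (λ q → sweptDiamond S (3 + ℓ) y q w) (diamondAt-clause j x lt) ⟩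
        sweptDiamond S (3 + ℓ) y (lookupOr (clauseDiamonds j) x (1 , ⊤')) w ≡⟨ sweptDiamond-complete ones (lookupOr (clauseDiamonds j) x (1 , ⊤')) w ⟩
        diamondVal w (lookupOr (clauseDiamonds j) x (1 , ⊤'))           ∎
        where open ≡-Reasoning

      next-counter : allOnes y ≡ true → increment y ≡ zeros ℓ
      next-counter ones = trans (increment-allOnes y ones) (cong zeros length-y)

      invariant-nextRound : allOnes y ≡ true → Invariant (suc N′) stepP 0 (zeros ℓ)
      invariant-nextRound ones = subst (Invariant (suc N′) stepP 0) (next-counter ones) (record
        { s≤3+ℓ    = z≤n
        ; length-y = length-increment-y
        ; at-out   = λ j w → trans (tick-out j w)
                       (trans (cong₂ _∧_ (wrapped-end w) (update-correct ones j w))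
                              (cong (_∧ stepP j w) (trans ones (sym (trans (allZeros-increment y) ones)))))
        ; at-reg   = λ j w → trans (tick-reg j w)
                       (trans (cong (λ b → (b ∧ ev (update j) w) ∨ (not b ∧ H (ix reg (toℕ j)) w)) (trans (wrapped-end w) ones))
                              (trans (∨-identityʳ _) (update-correct ones j w)))
        ; at-clk   = clk-end
        ; at-bit   = bit-end
        ; at-carry = carry-end
        ; at-wrap  = wrap-end
        ; at-match = match-end
        ; at-rank  = λ j lt w → trans (rank-next j lt w) (trans (cong (λ b → not b ∧ _) (trans (wrapped-end w) ones))
                       (sym (cong (suc j ≤ᵇ_) (trans (cong (λ z → #below z w) (next-counter ones)) (#below-zeros w)))))
        ; at-dia   = λ g lt w → trans (dia-next g lt w) (trans (cong (λ b → not b ∧ _) (trans (wrapped-end w) ones))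
                       (sym (trans (cong (λ z → sweptDiamond stepP 0 z (diamondAt g) w) (next-counter ones))
                                   (sweptDiamond-start stepP (diamondAt g) w))))
        })

      swept-increment : allOnes y ≡ false → ∀ v → Swept (4 + ℓ) (idOf v) y ≡ Swept 0 (idOf v) (increment y)
      swept-increment notOnes v = sym (lexLt-increment (idOf v) y (trans (length-idOf v) (sym length-y)) notOnes)

      sweptDiamond-increment : allOnes y ≡ false → ∀ q w → sweptDiamond S (4 + ℓ) y q w ≡ sweptDiamond S 0 (increment y) q w
      sweptDiamond-increment notOnes (i , φ) w = anyF-cong ∣W∣ λ v →
        cong (λ b → R M w v ∧ (b ∧ (mpEval isId Π M S φ v ∧ (suc (#below (idOf v) w) ≡ᵇ i)))) (swept-increment notOnes v)

      invariant-nextSweep : allOnes y ≡ false → Invariant (suc N′) S 0 (increment y)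
      invariant-nextSweep notOnes = record
        { s≤3+ℓ    = z≤n
        ; length-y = length-increment-y
        ; at-out   = λ j w → trans (tick-out j w) (trans (cong (_∧ ev (update j) w) (trans (wrapped-end w) notOnes))
                       (sym (cong (_∧ S j w) (trans (allZeros-increment y) notOnes))))
        ; at-reg   = λ j w → trans (tick-reg j w)
                       (trans (cong (λ b → (b ∧ ev (update j) w) ∨ (not b ∧ H (ix reg (toℕ j)) w)) (trans (wrapped-end w) notOnes))
                              (at-reg j w))
        ; at-clk   = clk-end
        ; at-bit   = bit-end
        ; at-carry = carry-end
        ; at-wrap  = wrap-end
        ; at-match = match-end
        ; at-rank  = λ j lt w → trans (rank-next j lt w) (cong₂ (λ b c → not b ∧ (suc j ≤ᵇ c)) (trans (wrapped-end w) notOnes)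
                       (countF-cong ∣W∣ (λ u → cong (R M w u ∧_) (swept-increment notOnes u))))
        ; at-dia   = λ g lt w → trans (dia-next g lt w) (cong₂ (λ b c → not b ∧ c) (trans (wrapped-end w) notOnes)
                       (sweptDiamond-increment notOnes (diamondAt g) w))
        }

    roundP : ℕ → Fin κ → World M → Bool
    roundP = mpRound isId Π P M

    invariant : ∀ N → Invariant N (roundP (phase (clock N))) (offset (clock N)) (counter (clock N))
    invariant zero    = invariant-start
    invariant (suc N) with clock N | invariant N
    ... | ⟨ p , y , s ⟩ | inv with s ≡ᵇ 3 + ℓ in s≟
    ...   | false = Sweep.invariant-mid N (roundP p) s y inv (≤∧≢⇒< (Invariant.s≤3+ℓ inv) (λ eq → subst T s≟ (≡⇒≡ᵇ s (3 + ℓ) eq)))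
    ...   | true with refl ← ≡ᵇ⇒≡′ {s} {3 + ℓ} s≟ with allOnes y in ones
    ...     | true  = SweepEnd.invariant-nextRound N (roundP p) y inv ones
    ...     | false = SweepEnd.invariant-nextSweep N (roundP p) y inv ones

    atStart : ℕ → Bool
    atStart N = (offset (clock N) ≡ᵇ 0) ∧ allZeros (counter (clock N))

    configQ : ℕ → World M → Fin K → Bool
    configQ N w i = mscRound Q M N i w

    configP : ℕ → World M → Fin κ → Bool
    configP p w j = roundP p j w

    out-config : ∀ N w j → configQ N w (j ↑ˡ widths internal) ≡ atStart N ∧ configP (phase (clock N)) w j
    out-config N w j = begin
      mscRound Q M N (j ↑ˡ widths internal) w              ≡⟨ headVal-toℕ M N (j ↑ˡ widths internal) w ⟩
      headVal M N (toℕ (j ↑ˡ widths internal)) w            ≡⟨ cong (λ x → headVal M N x w) (FP.toℕ-↑ˡ j (widths internal)) ⟩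
      headVal M N (toℕ j) w                                  ≡⟨ Invariant.at-out (invariant N) j w ⟩
      atStart N ∧ configP (phase (clock N)) w j              ∎
      where open ≡-Reasoning

    hit-Q : ∀ N w → hit (att Q) (configQ N w) ≡ atStart N ∧ hit (att P) (configP (phase (clock N)) w)
    hit-Q N w = trans (hit-padded _ (att P) (configQ N w))
                  (trans (hit-cong (att P) (out-config N w)) (hit-∧ˡ (att P) (atStart N) _))

    print-Q : ∀ N w → restrict (prn Q) (configQ N w) ≡ restrict (prn P) (λ j → atStart N ∧ configP (phase (clock N)) w j)
    print-Q N w = trans (restrict-padded _ (prn P) (configQ N w)) (restrict-cong (prn P) (out-config N w))

    atStart-roundStart : ∀ p → atStart (p * roundLength) ≡ true
    atStart-roundStart p rewrite clock-roundStart p = allZeros-zeros ℓ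

    hit-Q-roundStart : ∀ p w → hit (att Q) (configQ (p * roundLength) w) ≡ hit (att P) (configP p w)
    hit-Q-roundStart p w rewrite hit-Q (p * roundLength) w | atStart-roundStart p | clock-roundStart p = refl

    print-Q-roundStart : ∀ p w → restrict (prn Q) (configQ (p * roundLength) w) ≡ restrict (prn P) (configP p w)
    print-Q-roundStart p w rewrite print-Q (p * roundLength) w | atStart-roundStart p | clock-roundStart p = refl

    atStart⇒roundStart : ∀ N → atStart N ≡ true → N ≡ phase (clock N) * roundLength
    atStart⇒roundStart N e with offset (clock N) ≡ᵇ 0 in s≟
    ... | true = roundStart-time N (≡ᵇ⇒≡′ s≟) e

    outputs-forward : ∀ w n o → MPOutputs isId Π P M w n o → MSCOutputs Q M w (n * roundLength) o
    outputs-forward w n o ((accepts , silent) , printed) =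
      (subst T (sym (hit-Q-roundStart n w)) accepts , silent′) , trans (print-Q-roundStart n w) printed
      where
      silent′ : ∀ m → m < n * roundLength → hit (att Q) (configQ m w) ≡ false
      silent′ m lt with atStart m in e
      ... | false = trans (hit-Q m w) (cong (_∧ hit (att P) (configP (phase (clock m)) w)) e)
      ... | true  = trans (hit-Q m w) (trans (cong (_∧ hit (att P) (configP (phase (clock m)) w)) e)
                      (silent (phase (clock m)) (*-cancelʳ-< roundLength (phase (clock m)) n (subst (_< n * roundLength) (atStart⇒roundStart m e) lt))))

    outputs-backward : ∀ w N o → MSCOutputs Q M w N o → MPOutputs isId Π P M w (phase (clock N)) o
    outputs-backward w N o ((accepts , silent) , printed) with atStart N in e | subst T (hit-Q N w) accepts
    ... | true | acceptsP = (acceptsP , silent′) , trans (sym (restrict-cong (prn P) (λ j → cong (_∧ configP (phase (clock N)) w j) e)))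
                                                         (trans (sym (print-Q N w)) printed)
      where
      silent′ : ∀ m → m < phase (clock N) → hit (att P) (configP m w) ≡ false
      silent′ m lt = trans (sym (hit-Q-roundStart m w))
                       (silent (m * roundLength) (subst (m * roundLength <_) (sym (atStart⇒roundStart N e))
                         (*-monoˡ-< roundLength {{>-nonZero roundLength>0}} lt)))

  mpSizeF-suc : ∀ (φ : MPFm κ) → ∃[ a ] mpSizeF φ ≡ suc a
  mpSizeF-suc ⊤'         = 0 , refl
  mpSizeF-suc (prop _)   = 0 , refl
  mpSizeF-suc (hd _)     = 0 , refl
  mpSizeF-suc (¬' φ)     = _ , refl
  mpSizeF-suc (φ ∧' ψ)   = _ , refl
  mpSizeF-suc (◇[ _ ] φ) = _ , refl

  size-translateTerm : (φ : MPFm 0) → size (translateTerm φ) ≤ mpSizeF φ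
  size-translateTerm ⊤'         = ≤-refl
  size-translateTerm (prop _)   = ≤-refl
  size-translateTerm (hd ())
  size-translateTerm (¬' φ)     = s≤s (size-translateTerm φ)
  size-translateTerm (φ ∧' ψ)   = s≤s (+-mono-≤ (size-translateTerm φ) (size-translateTerm ψ))
  size-translateTerm (◇[ _ ] φ) = s≤s z≤n

  size-translate₀ : ∀ ψ → size (translate₀ ψ) ≤ mpSizeF ψ
  size-translate₀ ⊤'         = ≤-refl
  size-translate₀ (prop _)   = ≤-refl
  size-translate₀ (hd _)     = ≤-refl
  size-translate₀ (¬' φ)     = s≤s (size-translate₀ φ)
  size-translate₀ (φ ∧' ψ)   = s≤s (+-mono-≤ (size-translate₀ φ) (size-translate₀ ψ))
  size-translate₀ (◇[ _ ] φ) = s≤s z≤n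

  size-translate : ∀ c ψ → size (translate c ψ) ≤ mpSizeF ψ
  size-translate c ⊤'         = ≤-refl
  size-translate c (prop _)   = ≤-refl
  size-translate c (hd _)     = ≤-refl
  size-translate c (¬' φ)     = s≤s (size-translate c φ)
  size-translate c (φ ∧' ψ)   = s≤s (+-mono-≤ (size-translate c φ) (size-translate _ ψ))
  size-translate c (◇[ _ ] φ) = s≤s z≤n

  size-translateCond : ∀ c cs χ → size (translateCond c cs χ) ≤ 6 * (sizePairs cs + mpSizeF χ)
  size-translateCond c []             χ = ≤-trans (size-translate c χ) (m≤n*m (mpSizeF χ) 6)
  size-translateCond c ((φ , ψ) ∷ cs) χ with mpSizeF-suc φ | mpSizeF-suc ψ
  ... | a , ea | b , eb = begin
    size ((translate c φ ∧' translate c′ ψ) ∨' (¬' (translate c φ) ∧' translateCond c″ cs χ))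
      ≡⟨ size-∨' (translate c φ ∧' translate c′ ψ) (¬' (translate c φ) ∧' translateCond c″ cs χ) ⟩
    4 + suc (size (translate c φ) + size (translate c′ ψ)) + suc (suc (size (translate c φ)) + size (translateCond c″ cs χ))
      ≤⟨ +-mono-≤ (+-monoʳ-≤ 4 (s≤s (+-mono-≤ (size-translate c φ) (size-translate c′ ψ))))
                  (s≤s (+-mono-≤ (s≤s (size-translate c φ)) (size-translateCond c″ cs χ))) ⟩
    4 + suc (mpSizeF φ + mpSizeF ψ) + suc (suc (mpSizeF φ) + 6 * (sizePairs cs + mpSizeF χ))
      ≡⟨ cong₂ (λ x y → 4 + suc (x + y) + suc (suc x + 6 * (sizePairs cs + mpSizeF χ))) ea eb ⟩
    4 + suc (suc a + suc b) + suc (suc (suc a) + 6 * (sizePairs cs + mpSizeF χ))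
      ≤⟨ m≤m+n _ (2 + 4 * a + 5 * b) ⟩
    4 + suc (suc a + suc b) + suc (suc (suc a) + 6 * (sizePairs cs + mpSizeF χ)) + (2 + 4 * a + 5 * b)
      ≡⟨ sym (six-times a b (sizePairs cs) (mpSizeF χ)) ⟩
    6 * (suc a + suc b + sizePairs cs + mpSizeF χ)
      ≡⟨ cong₂ (λ x y → 6 * (x + y + sizePairs cs + mpSizeF χ)) (sym ea) (sym eb) ⟩
    6 * (sizePairs ((φ , ψ) ∷ cs) + mpSizeF χ) ∎
    where
    open ≤-Reasoning
    c′ = c + length (diamonds φ)
    c″ = c′ + length (diamonds ψ)
    six-times : ∀ a b p q → 6 * (suc a + suc b + p + q)
                          ≡ 4 + suc (suc a + suc b) + suc (suc (suc a) + 6 * (p + q)) + (2 + 4 * a + 5 * b)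
    six-times = solve-∀

  size-update : ∀ j → size (update j) ≤ 6 * clauseSize (iter P j)
  size-update j with iter P j
  ... | std ψ           = ≤-trans (size-translate _ ψ) (m≤n*m (mpSizeF ψ) 6)
  ... | cond (x ∷ xs) χ = size-translateCond _ (x ∷ xs) χ

  diamondCost : ℕ × MPFm κ → ℕ
  diamondCost (_ , φ) = suc (mpSizeF φ)

  diamondCost-diamonds : ∀ ψ → sum (map diamondCost (diamonds ψ)) ≤ mpSizeF ψ
  diamondCost-diamonds ⊤'         = z≤n
  diamondCost-diamonds (prop _)   = z≤n
  diamondCost-diamonds (hd _)     = z≤n
  diamondCost-diamonds (¬' φ)     = ≤-trans (diamondCost-diamonds φ) (n≤1+n _)
  diamondCost-diamonds (φ ∧' ψ)   =
    ≤-trans (≤-reflexive (trans (cong sum (LP.map-++ diamondCost (diamonds φ) (diamonds ψ))) (sum-++ (map diamondCost (diamonds φ)) _)))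
            (≤-trans (+-mono-≤ (diamondCost-diamonds φ) (diamondCost-diamonds ψ)) (n≤1+n _))
  diamondCost-diamonds (◇[ _ ] φ) = ≤-reflexive (+-identityʳ _)

  diamondCost-diamondsClause : ∀ cl → sum (map diamondCost (diamondsClause cl)) ≤ clauseSize cl
  diamondCost-diamondsClause (std ψ)           = diamondCost-diamonds ψ
  diamondCost-diamondsClause (cond (c ∷ cs) χ) = go (c ∷ cs) χ
    where
    go : ∀ cs χ → sum (map diamondCost (diamondsCond cs χ)) ≤ sizePairs cs + mpSizeF χ
    go []             χ = diamondCost-diamonds χ
    go ((φ , ψ) ∷ cs) χ = begin
      sum (map diamondCost (diamonds φ ++ (diamonds ψ ++ diamondsCond cs χ)))
        ≡⟨ sum-map-++ diamondCost (diamonds φ) _ ⟩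
      sum (map diamondCost (diamonds φ)) + sum (map diamondCost (diamonds ψ ++ diamondsCond cs χ))
        ≡⟨ cong (sum (map diamondCost (diamonds φ)) +_) (sum-map-++ diamondCost (diamonds ψ) _) ⟩
      sum (map diamondCost (diamonds φ)) + (sum (map diamondCost (diamonds ψ)) + sum (map diamondCost (diamondsCond cs χ)))
        ≤⟨ +-mono-≤ (diamondCost-diamonds φ) (+-mono-≤ (diamondCost-diamonds ψ) (go cs χ)) ⟩
      mpSizeF φ + (mpSizeF ψ + (sizePairs cs + mpSizeF χ))
        ≡⟨ reassociate (mpSizeF φ) (mpSizeF ψ) (sizePairs cs) (mpSizeF χ) ⟩
      mpSizeF φ + mpSizeF ψ + sizePairs cs + mpSizeF χ ∎
      where
      open ≤-Reasoning
      reassociate : ∀ a b c d → a + (b + (c + d)) ≡ a + b + c + d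
      reassociate = solve-∀

  clauseWeight : Fin κ → ℕ
  clauseWeight j = suc (mpSizeF (term P j)) + suc (clauseSize (iter P j))

  cost : ℕ → ℕ
  cost x = suc (size (initClause x)) + suc (size (stepClause x))

  cost-ix : ∀ b x → x < width b → cost (ix b x) ≡ suc (size (initBody b x)) + suc (size (stepBody b x))
  cost-ix b x lt = cong₂ (λ φ ψ → suc (size φ) + suc (size ψ)) (place-ix initBody b x lt) (place-ix stepBody b x lt)

  size-atLeast : ∀ j → size (atLeast j) ≡ 1
  size-atLeast zero    = refl
  size-atLeast (suc j) = refl

  ≡+⇒≤ : ∀ {a b} d → b ≡ a + d → a ≤ b
  ≡+⇒≤ {a} d e = ≤-trans (m≤m+n a d) (≤-reflexive (sym e))

  cost-out : ∀ j → cost (ix out (toℕ j)) ≤ 6 * clauseWeight j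
  cost-out j rewrite cost-ix out (toℕ j) (FP.toℕ<n j) | onFin-toℕ (translateTerm ∘ term P) j | onFin-toℕ (λ j → wrapH ∧' update j) j =
    ≤-trans (+-mono-≤ (s≤s (size-translateTerm (term P j))) (s≤s (s≤s (s≤s (size-update j)))))
            (≡+⇒≤ (8 + 5 * mpSizeF (term P j)) (bound (mpSizeF (term P j)) (clauseSize (iter P j))))
    where
    bound : ∀ a b → 6 * (suc a + suc b) ≡ (suc a + suc (suc (suc (6 * b)))) + (8 + 5 * a)
    bound = solve-∀

  cost-reg : ∀ j → cost (ix reg (toℕ j)) ≤ 12 * clauseWeight j
  cost-reg j rewrite cost-ix reg (toℕ j) (FP.toℕ<n j) | onFin-toℕ (translateTerm ∘ term P) j
                   | onFin-toℕ (λ j → (wrapH ∧' update j) ∨' (¬' wrapH ∧' hd (ix reg (toℕ j)))) j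
                   | size-∨' (wrapH ∧' update j) (¬' wrapH ∧' hd (ix reg (toℕ j))) =
    ≤-trans (+-mono-≤ (s≤s (size-translateTerm (term P j))) (s≤s (+-monoˡ-≤ 4 (+-monoʳ-≤ 4 (s≤s (s≤s (size-update j)))))))
            (≡+⇒≤ (12 + 11 * mpSizeF (term P j) + 6 * clauseSize (iter P j)) (bound (mpSizeF (term P j)) (clauseSize (iter P j))))
    where
    bound : ∀ a b → 12 * (suc a + suc b) ≡ (suc a + suc (4 + suc (suc (6 * b)) + 4)) + (12 + 11 * a + 6 * b)
    bound = solve-∀

  cost-clk : ∀ x → x < width clk → cost (ix clk x) ≤ 5
  cost-clk zero    lt rewrite cost-ix clk 0 lt       = s≤s (s≤s (s≤s (s≤s z≤n)))
  cost-clk (suc x) lt rewrite cost-ix clk (suc x) lt = ≤-refl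

  cost-bit : ∀ i → i < width bit → cost (ix bit i) ≤ 16
  cost-bit i lt rewrite cost-ix bit i lt = ≤-refl

  cost-carry : ∀ i → i < width carry → cost (ix carry i) ≤ 7
  cost-carry i lt rewrite cost-ix carry i lt with i ≡ᵇ ℓ
  ... | true  = s≤s (s≤s (s≤s (s≤s (s≤s z≤n))))
  ... | false = ≤-refl

  cost-wrap : ∀ x → x < width wrap → cost (ix wrap x) ≤ 5
  cost-wrap x lt rewrite cost-ix wrap x lt = ≤-refl

  cost-match : ∀ x → x < width match → cost (ix match x) ≤ 4 + 32 * ℓ
  cost-match x lt rewrite cost-ix match x lt =
    ≤-trans (+-mono-≤ (s≤s (size-bitsMatch ids (λ _ → ⊥') (λ _ → ≤-refl))) (s≤s (size-bitsMatch ids (λ i → hd (ix bit i)) (λ _ → s≤s z≤n))))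
            (≤-reflexive (bound ℓ))
    where
    bound : ∀ l → suc (1 + 16 * l) + suc (1 + 16 * l) ≡ 4 + 32 * l
    bound = solve-∀

  cost-rank : ∀ j → j < width rank → cost (ix rank j) ≤ 18
  cost-rank j lt rewrite cost-ix rank j lt | size-atLeast j = ≤-refl

  cost-dia : ∀ g → g < width dia → cost (ix dia g) ≤ 22 * diamondCost (diamondAt g)
  cost-dia g lt rewrite cost-ix dia g lt | size-atLeast (proj₁ (diamondAt g) ∸ 1) | size-atLeast (proj₁ (diamondAt g)) =
    ≤-trans (≤-reflexive (cong (18 +_) (+-comm (size (translate₀ φ)) 4)))
      (≤-trans (+-monoʳ-≤ 22 (size-translate₀ φ)) (≡+⇒≤ (21 * mpSizeF φ) (bound (mpSizeF φ))))
    where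
    φ = proj₂ (diamondAt g)
    bound : ∀ x → 22 * suc x ≡ 22 + x + 21 * x
    bound = solve-∀

  sumF-clauseWeight : ∀ c (f : Fin κ → ℕ) → (∀ j → f j ≤ c * clauseWeight j) → sumF κ f ≤ c * mpSize P
  sumF-clauseWeight c f h = ≤-trans (sumF-mono κ f _ h) (≤-reflexive (sumF-* κ c clauseWeight))

  sumN-toℕ-clauseWeight : ∀ c (f : ℕ → ℕ) → (∀ j → f (toℕ j) ≤ c * clauseWeight j) → sumN κ f ≤ c * mpSize P
  sumN-toℕ-clauseWeight c f h = subst (_≤ c * mpSize P) (sumF-toℕ κ f) (sumF-clauseWeight c (f ∘ toℕ) h)

  cost-dias : sumN #diamonds (λ g → cost (ix dia g)) ≤ 22 * mpSize P
  cost-dias = begin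
    sumN #diamonds (λ g → cost (ix dia g))                          ≤⟨ sumN-mono #diamonds _ _ cost-dia ⟩
    sumN #diamonds (λ g → 22 * diamondCost (diamondAt g))           ≡⟨ sumN-* #diamonds 22 (diamondCost ∘ diamondAt) ⟩
    22 * sumN #diamonds (diamondCost ∘ diamondAt)                   ≡⟨ cong (22 *_) (sumN-lookupOr allDiamonds (1 , ⊤') diamondCost) ⟩
    22 * sum (map diamondCost allDiamonds)                          ≡⟨ cong (22 *_) (sum-concat κ clauseDiamonds diamondCost) ⟩
    22 * sumF κ (λ j → sum (map diamondCost (clauseDiamonds j)))   ≤⟨ *-monoʳ-≤ 22 (sumF-clauseWeight 1 _ λ j →
                                                                         ≤-trans (diamondCost-diamondsClause (iter P j))
                                                                           (≤-trans (n≤1+n _) (≤-trans (m≤n+m _ (suc (mpSizeF (term P j)))) (≤-reflexive (sym (*-identityˡ _)))))) ⟩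
    22 * (1 * mpSize P)                                             ≡⟨ cong (22 *_) (*-identityˡ (mpSize P)) ⟩
    22 * mpSize P                                                   ∎
    where open ≤-Reasoning

  -- The constant part of the size is absorbed by mpSize P, which is at least 2 once P has a head.
  sumN-cost : 2 ≤ mpSize P → sumN K cost ≤ 60 * (I + ℓ + mpSize P)
  sumN-cost m≥2 = begin
    sumN K cost          ≡⟨ sumN-widths blocks cost ⟩
    blockSums blocks cost
      ≤⟨ +-mono-≤ (sumN-toℕ-clauseWeight 6 cost cost-out) (+-mono-≤ (sumN-toℕ-clauseWeight 12 (λ x → cost (κ + x)) cost-reg)
         (+-mono-≤ (sumN-≤-* sweepLength _ 5 cost-clk) (+-mono-≤ (sumN-≤-* ℓ _ 16 cost-bit)
         (+-mono-≤ (sumN-≤-* (suc ℓ) _ 7 cost-carry) (+-mono-≤ (sumN-≤-* 1 _ 5 cost-wrap)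
         (+-mono-≤ (sumN-≤-* 1 _ (4 + 32 * ℓ) cost-match) (+-mono-≤ (sumN-≤-* I _ 18 cost-rank) (+-monoˡ-≤ 0 cost-dias)))))))) ⟩
    bound (mpSize P)     ≡⟨ cong bound (sym (m+[n∸m]≡n m≥2)) ⟩
    bound (2 + m)        ≤⟨ m≤m+n _ (42 * I + 4 + 20 * m) ⟩
    bound (2 + m) + (42 * I + 4 + 20 * m)  ≡⟨ sym (sixty I ℓ m) ⟩
    60 * (I + ℓ + (2 + m)) ≡⟨ cong (λ x → 60 * (I + ℓ + x)) (m+[n∸m]≡n m≥2) ⟩
    60 * (I + ℓ + mpSize P) ∎
    where
    open ≤-Reasoning
    m = mpSize P ∸ 2
    bound : ℕ → ℕ
    bound x = 6 * x + (12 * x + ((4 + ℓ) * 5 + (ℓ * 16 + (suc ℓ * 7 + (1 * 5 + (1 * (4 + 32 * ℓ) + (I * 18 + (22 * x + 0))))))))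
    sixty : ∀ i l m → 60 * (i + l + (2 + m))
      ≡ 6 * (2 + m) + (12 * (2 + m) + ((4 + l) * 5 + (l * 16 + (suc l * 7 + (1 * 5 + (1 * (4 + 32 * l) + (i * 18 + (22 * (2 + m) + 0))))))))
        + (42 * i + 4 + 20 * m)
    sixty = solve-∀

  Π₁⊆Π : All (_∈ elems Π) ids
  Π₁⊆Π = go (elems Π)
    where
    go : ∀ xs → All (_∈ xs) (idList isId xs)
    go []       = []
    go (x ∷ xs) with isId x
    ... | true  = here refl ∷ All.map there (go xs)
    ... | false = All.map there (go xs)

  SymsIn-translateTerm : (φ : MPFm 0) → mpOK Π φ → SymsIn Π (translateTerm φ)
  SymsIn-translateTerm ⊤'         o         = tt
  SymsIn-translateTerm (prop p)   o         = o
  SymsIn-translateTerm (hd ())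
  SymsIn-translateTerm (¬' φ)     o         = SymsIn-translateTerm φ o
  SymsIn-translateTerm (φ ∧' ψ)   (o₁ , o₂) = SymsIn-translateTerm φ o₁ , SymsIn-translateTerm ψ o₂
  SymsIn-translateTerm (◇[ i ] φ) o         = tt

  SymsIn-translate₀ : ∀ ψ → mpOK Π ψ → SymsIn Π (translate₀ ψ)
  SymsIn-translate₀ ⊤'         o         = tt
  SymsIn-translate₀ (prop p)   o         = o
  SymsIn-translate₀ (hd j)     o         = tt
  SymsIn-translate₀ (¬' φ)     o         = SymsIn-translate₀ φ o
  SymsIn-translate₀ (φ ∧' ψ)   (o₁ , o₂) = SymsIn-translate₀ φ o₁ , SymsIn-translate₀ ψ o₂
  SymsIn-translate₀ (◇[ i ] φ) o         = tt

  SymsIn-translate : ∀ c ψ → mpOK Π ψ → SymsIn Π (translate c ψ)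
  SymsIn-translate c ⊤'         o         = tt
  SymsIn-translate c (prop p)   o         = o
  SymsIn-translate c (hd j)     o         = tt
  SymsIn-translate c (¬' φ)     o         = SymsIn-translate c φ o
  SymsIn-translate c (φ ∧' ψ)   (o₁ , o₂) = SymsIn-translate c φ o₁ , SymsIn-translate _ ψ o₂
  SymsIn-translate c (◇[ i ] φ) o         = tt

  SymsIn-translateCond : ∀ c cs χ → All CondOK cs → mpOK Π χ → SymsIn Π (translateCond c cs χ)
  SymsIn-translateCond c []             χ _                     o = SymsIn-translate c χ o
  SymsIn-translateCond c ((φ , ψ) ∷ cs) χ ((o₁ , _ , o₂ , _) ∷ ok) o =
    (SymsIn-translate c φ o₁ , SymsIn-translate _ ψ o₂) , (SymsIn-translate c φ o₁ , SymsIn-translateCond _ cs χ ok o)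

  SymsIn-update : MPWF Π P → ∀ j → SymsIn Π (update j)
  SymsIn-update wf j with iter P j | proj₂ (wf j)
  ... | std ψ           | o , _      = SymsIn-translate _ ψ o
  ... | cond (x ∷ xs) χ | ok , o , _ = SymsIn-translateCond _ (x ∷ xs) χ ok o

  SymsIn-onFin : ∀ f → (∀ j → SymsIn Π (f j)) → ∀ x → SymsIn Π (onFin f x)
  SymsIn-onFin f h x with toFin? κ x
  ... | just j  = h j
  ... | nothing = tt

  SymsIn-atLeast : ∀ j → SymsIn Π (atLeast j)
  SymsIn-atLeast zero    = tt
  SymsIn-atLeast (suc j) = tt

  diamondAt-mpOK : MPWF Π P → ∀ g → mpOK Π (proj₂ (diamondAt g))
  diamondAt-mpOK wf = All-lookupOr {P = λ q → mpOK Π (proj₂ q)} (All.map (proj₂ ∘ proj₂ ∘ proj₂) (allDiamonds-OK wf)) tt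

  SymsIn-stepBody : MPWF Π P → ∀ b x → SymsIn Π (stepBody b x)
  SymsIn-stepBody wf out   x       = SymsIn-onFin _ (λ j → tt , SymsIn-update wf j) x
  SymsIn-stepBody wf reg   x       = SymsIn-onFin _ (λ j → (tt , SymsIn-update wf j) , (tt , tt)) x
  SymsIn-stepBody wf clk   zero    = tt
  SymsIn-stepBody wf clk   (suc x) = tt
  SymsIn-stepBody wf bit   x       = (tt , tt) , (tt , tt)
  SymsIn-stepBody wf carry x with x ≡ᵇ ℓ
  ... | true  = tt
  ... | false = tt , tt
  SymsIn-stepBody wf wrap  x       = tt
  SymsIn-stepBody wf match x       = SymsIn-bitsMatch Π ids _ Π₁⊆Π (λ _ → tt)
  SymsIn-stepBody wf rank  j       = tt , (tt , (tt , (SymsIn-atLeast j , tt)))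
  SymsIn-stepBody wf dia   g       =
    tt , (tt , (tt , ((tt , SymsIn-translate₀ (proj₂ (diamondAt g)) (diamondAt-mpOK wf g)) , (SymsIn-atLeast (proj₁ (diamondAt g) ∸ 1) , SymsIn-atLeast (proj₁ (diamondAt g))))))

  SymsIn-initBody : MPWF Π P → ∀ b x → SymsIn Π (initBody b x)
  SymsIn-initBody wf out   x       = SymsIn-onFin _ (λ j → SymsIn-translateTerm (term P j) (proj₁ (proj₁ (wf j)))) x
  SymsIn-initBody wf reg   x       = SymsIn-onFin _ (λ j → SymsIn-translateTerm (term P j) (proj₁ (proj₁ (wf j)))) x
  SymsIn-initBody wf clk   zero    = tt
  SymsIn-initBody wf clk   (suc x) = tt
  SymsIn-initBody wf bit   x       = tt
  SymsIn-initBody wf carry x       = tt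
  SymsIn-initBody wf wrap  x       = tt
  SymsIn-initBody wf match x       = SymsIn-bitsMatch Π ids _ Π₁⊆Π (λ _ → tt)
  SymsIn-initBody wf rank  x       = tt
  SymsIn-initBody wf dia   x       = tt

  Q-wellFormed : MPWF Π P → MSCWF Π Q
  Q-wellFormed wf i =
    SymsIn-compile Π 0 (initClause (toℕ i)) (place-preserves (SymsIn Π) {initBody} tt (SymsIn-initBody wf) blocks (toℕ i)) ,
    SymsIn-compile Π K (stepClause (toℕ i)) (place-preserves (SymsIn Π) {stepBody} tt (SymsIn-stepBody wf) blocks (toℕ i))

  equivalent : MPWF Π P → Equivalent isId Π P Q
  equivalent wf M hid w o =
    (λ (n , outputs) → n * roundLength , Run.outputs-forward M wf hid w n o outputs) ,
    (λ (N′ , outputs) → _ , Run.outputs-backward M wf hid w N′ o outputs)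

  time-bound : MPWF Π P → ∀ c → roundLength ≤ c * 2 ^ (c * ℓ) → TimeBound isId Π c P Q
  time-bound wf c bound M hid w n o outputs = n * roundLength , Run.outputs-forward M wf hid w n o outputs , (begin
    n * roundLength                 ≤⟨ *-monoˡ-≤ roundLength (n≤1+n n) ⟩
    suc n * roundLength             ≤⟨ *-monoʳ-≤ (suc n) bound ⟩
    suc n * (c * 2 ^ (c * ℓ))       ≡⟨ *-comm (suc n) _ ⟩
    c * 2 ^ (c * ℓ) * suc n         ∎)
    where open ≤-Reasoning

  size-bound : 1 ≤ κ → mscSize Q ≤ 60 * (I + ℓ + mpSize P)
  size-bound κ≥1 = begin
    mscSize Q          ≡⟨ sumF-cong K (λ i → cong₂ (λ a b → suc a + suc b) (size-compile 0 (initClause (toℕ i))) (size-compile K (stepClause (toℕ i)))) ⟩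
    sumF K (cost ∘ toℕ) ≡⟨ sumF-toℕ K cost ⟩
    sumN K cost         ≤⟨ sumN-cost (2≤sumF κ clauseWeight (λ j → s≤s (≤-trans (s≤s z≤n) (m≤n+m _ _))) κ≥1) ⟩
    60 * (I + ℓ + mpSize P) ∎
    where open ≤-Reasoning

4+n≤4*2^n : ∀ n → 4 + n ≤ 4 * 2 ^ n
4+n≤4*2^n zero    = ≤-refl
4+n≤4*2^n (suc n) = begin
  suc (4 + n)             ≤⟨ s≤s (4+n≤4*2^n n) ⟩
  suc (4 * 2 ^ n)         ≤⟨ +-monoˡ-≤ (4 * 2 ^ n) (≤-trans (m^n>0 2 n) (m≤n*m (2 ^ n) 4)) ⟩
  4 * 2 ^ n + 4 * 2 ^ n   ≡⟨ double (2 ^ n) ⟩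
  4 * 2 ^ suc n           ∎
  where
  open ≤-Reasoning
  double : ∀ y → 4 * y + 4 * y ≡ 4 * (2 * y)
  double = solve-∀

2^n*[4+n]≤60*2^[60n] : ∀ n → 2 ^ n * (4 + n) ≤ 60 * 2 ^ (60 * n)
2^n*[4+n]≤60*2^[60n] n = begin
  2 ^ n * (4 + n)          ≤⟨ *-monoʳ-≤ (2 ^ n) (4+n≤4*2^n n) ⟩
  2 ^ n * (4 * 2 ^ n)      ≡⟨ swap (2 ^ n) ⟩
  4 * (2 ^ n * 2 ^ n)      ≤⟨ *-monoˡ-≤ (2 ^ n * 2 ^ n) (m≤m+n 4 56) ⟩
  60 * (2 ^ n * 2 ^ n)     ≡⟨ cong (60 *_) (sym (^-distribˡ-+-* 2 n n)) ⟩
  60 * 2 ^ (n + n)         ≤⟨ *-monoʳ-≤ 60 (^-monoʳ-≤ 2 (≤-trans (m≤m+n (n + n) (58 * n)) (≤-reflexive (sixty n)))) ⟩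
  60 * 2 ^ (60 * n)        ∎
  where
  open ≤-Reasoning
  swap : ∀ y → y * (4 * y) ≡ 4 * (y * y)
  swap = solve-∀
  sixty : ∀ n → n + n + 58 * n ≡ 60 * n
  sixty = solve-∀

Simulable : ℕ → (ℕ → Bool) → SymSet → MPProg → Set
Simulable c isId Π P = ∃[ Q ] (MSCWF Π Q × Equivalent isId Π P Q
                               × mscSize Q ≤ c * (maxIndex P + length (Π₁ isId Π) + mpSize P) × TimeBound isId Π c P Q)

-- A program without heads never accepts, hence is simulated by the empty program.
simulable-no-heads : ∀ c isId Π P → k P ≡ 0 → Simulable c isId Π P
simulable-no-heads c isId Π P κ≡0 = Q∅ , (λ ()) , (λ M hid w o → (λ (_ , ((acc , _) , _)) → ⊥-elim (silent acc)) , (λ { (_ , ((() , _) , _)) }))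
                                   , z≤n , (λ M hid w n o ((acc , _) , _) → ⊥-elim (silent acc))
  where
  Q∅ : MSCProg
  Q∅ = record { k = 0 ; term = λ () ; iter = λ () ; att = [] ; prn = [] }
  hit-empty : ∀ {n} (A : Vec Bool n) b → n ≡ 0 → hit A b ≡ false
  hit-empty [] b _ = refl
  silent : ∀ {b} → T (hit (att P) b) → ⊥
  silent {b} acc = subst T (hit-empty (att P) b κ≡0) acc

simulable : ∀ isId Π P → MPWF Π P → ∀ n → k P ≡ n → Simulable 60 isId Π P
simulable isId Π P wf zero    κ≡0 = simulable-no-heads 60 isId Π P κ≡0
simulable isId Π P wf (suc _) κ≡  =
  Q , Q-wellFormed wf , equivalent wf , size-bound (subst (1 ≤_) (sym κ≡) (s≤s z≤n)) , time-bound wf 60 (2^n*[4+n]≤60*2^[60n] ℓ)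
  where open Simulation isId Π P

theorem3 : ∃[ c ] (∀ (isId : ℕ → Bool) (Π : SymSet) (P : MPProg) → MPWF Π P →
             ∃[ Q ] (MSCWF Π Q
                     × Equivalent isId Π P Q
                     × mscSize Q ≤ c * (maxIndex P + length (Π₁ isId Π) + mpSize P)
                     × TimeBound isId Π c P Q))
theorem3 = 60 , λ isId Π P wf → simulable isId Π P wf (k P) refl
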